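{- Let $\mathcal{S}$ be a commutative semiring and $\Sigma$ a finite alphabet. For every formula $\phi\in\mathbf{RMSOL}$ (over $\mathcal{S}$ and $\Sigma$) there is an expression $tr'(\phi)\in\mathbf{MSOLEVAL}_{\mathcal{S}}$ such that $WE(\phi,w,\sigma)=E(tr'(\phi),w,\sigma)$ for every word $w$ and every assignment $\sigma$ of the free variables; i.e., $\phi$ and $tr'(\phi)$ define the same word function.
   Context: Word structures: a word $w=\sigma_1\cdots\sigma_n\in\Sigma^{\star}$ is represented by the structure $\mathcal{A}_w$ with universe $\{0,1,\dots,n\}$, the natural linear order $\le$, and unary predicates $P_a=\{i\in\{1,\dots,n\}:\sigma_i=a\}$ for $a\in\Sigma$. Variables range over positions of $w$ (first-order variables) and sets of positions (set variables); an assignment $\sigma$ maps free variables to these. $\mathbf{MSOLEVAL}_{\mathcal{S}}$ expressions: built inductively from monomials $\prod_{v:\phi(v)} r$ (with $r\in\mathcal{S}$ and $\phi$ an $\mathbf{MSOL}$ formula; value $r^{k}$ where $k$ is the number of elements $v$ satisfying $\phi$) closed under finite products of monomials and under sums $\sum_{\bar R:\phi(\bar R)} t$ over tuples $\bar R$ of subsets of the universe satisfying an $\mathbf{MSOL}$ formula $\phi$, where $t$ is an expression that may mention $\bar R$. Expressions may have free first-order and set variables occurring in their formulas; $E(t,w,\sigma)$ denotes the value in $\mathcal{S}$ of $t$ on $\mathcal{A}_w$ under assignment $\sigma$. Weighted MSOL ($\mathbf{WMSOL}$): formulas given by $\phi::= k\mid P_a(x)\mid\neg P_a(x)\mid x\le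 y\mid\neg x\le y\mid x\in X\mid x\notin X\mid\phi\vee\psi\mid\phi\wedge\psi\mid\exists x.\phi\mid\exists X.\phi\mid\forall x.\phi\mid\forall X.\phi$ with $k\in\mathcal{S}$, $a\in\Sigma$. Semantics $WE(\phi,w,\sigma)\in\mathcal{S}$: $WE(k)=k$; an atomic formula evaluates to $1$ if true and $0$ if false under $\sigma$; a negated atomic formula evaluates to $1$ if the atom is false and $0$ otherwise; $\vee$ is semiring sum, $\wedge$ semiring product; $\exists x$ (resp. $\exists X$) is the sum over all positions (resp. all sets of positions) of the value of the body; $\forall x$ (resp. $\forall X$) is the product over all positions (resp. all sets of positions) of the value of the body. $\mathbf{bMSOL}$: formulas $\phi::=0\mid1\mid P_a(x)\mid x\le y\mid x\in X\mid\neg\phi\mid\phi\wedge\psi\mid\forall x.\phi\mid\forall X.\phi$; their evaluation takes values in $\{0,1\}$ and coincides with the standard Boolean semantics of $\phi$ as an unweighted MSOL formula. A $\mathbf{bMSOL}$-step formula is a formula $\bigvee_{i\in I}(\phi_i\wedge k_i)$ with $I$ finite, $\phi_i\in\mathbf{bMSOL}$, $k_i\in\mathcal{S}$. $\mathbf{RMSOL}$ is the fragment of $\mathbf{WMSOL}$ in which universal second-order quantification $\forall X.\psi$ is allowed only for $\psi\in\mathbf{bMSOL}$ and universal first-order quantification $\forall x.\psi$ only for $\mathbf{bMSOL}$-step formulas $\psi$. -}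

module Defs where

open import Level using (Level)
open import Data.Nat using (ℕ; zero; suc; _≡ᵇ_; _≤ᵇ_)
open import Data.Fin using (Fin; toℕ; _≟_) renaming (zero to fzero; suc to fsuc)
open import Data.Bool using (Bool; true; false; not; _∧_; _∨_; if_then_else_)
open import Data.List using (List; []; _∷_; length; lookup; map; foldr; allFin; concatMap)
open import Data.Vec using (Vec; []; _∷_) renaming (lookup to vlookup)
open import Data.Maybe using (Maybe; just; nothing)
open import Relation.Nullary.Decidable using (⌊_⌋)
open import Algebra.Bundles using (CommutativeSemiring)

-- A word w is a List (Fin k); the universe of A_w is {0,…,n}, n = length w,
-- represented as Fin (suc n) with the natural order on toℕ.

Word : ℕ → Set
Word k = List (Fin k)

Pos : ∀ {k} → Word k → Set
Pos w = Fin (suc (length w))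

PSet : ∀ {k} → Word k → Set
PSet w = Vec Bool (suc (length w))

-- letter at position i ∈ {1..n}; position 0 carries no letter
letterAt : ∀ {k} (w : Word k) → Pos w → Maybe (Fin k)
letterAt w fzero = nothing
letterAt w (fsuc j) = just (lookup w j)

isLetter : ∀ {k} (w : Word k) → Fin k → Pos w → Bool
isLetter w a i with letterAt w i
... | nothing = false
... | just b = ⌊ a ≟ b ⌋

allVecs : (n : ℕ) → List (Vec Bool n)
allVecs zero = [] ∷ []
allVecs (suc n) = concatMap (λ v → (false ∷ v) ∷ (true ∷ v) ∷ []) (allVecs n)

allPos : ∀ {k} (w : Word k) → List (Pos w)
allPos w = allFin (suc (length w))

allSets : ∀ {k} (w : Word k) → List (PSet w)
allSets w = allVecs (suc (length w))

record Assign {k} (w : Word k) : Set where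
  constructor ⟨_,_⟩
  field
    fo : ℕ → Pos w
    so : ℕ → PSet w
open Assign public

_[_↦₁_] : ∀ {k} {w : Word k} → Assign w → ℕ → Pos w → Assign w
σ [ x ↦₁ i ] = ⟨ (λ y → if y ≡ᵇ x then i else fo σ y) , so σ ⟩

_[_↦₂_] : ∀ {k} {w : Word k} → Assign w → ℕ → PSet w → Assign w
σ [ X ↦₂ A ] = ⟨ fo σ , (λ Y → if Y ≡ᵇ X then A else so σ Y) ⟩

leq : ∀ {k} {w : Word k} → Pos w → Pos w → Bool
leq i j = toℕ i ≤ᵇ toℕ j

mem : ∀ {k} {w : Word k} → Pos w → PSet w → Bool
mem i A = vlookup A i

allB : ∀ {a} {A : Set a} → (A → Bool) → List A → Bool
allB p = foldr (λ x b → p x ∧ b) true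

anyB : ∀ {a} {A : Set a} → (A → Bool) → List A → Bool
anyB p = foldr (λ x b → p x ∨ b) false

data MSOL (k : ℕ) : Set where
  ⊤' ⊥'   : MSOL k
  P       : Fin k → ℕ → MSOL k
  _≤'_    : ℕ → ℕ → MSOL k
  _∈'_    : ℕ → ℕ → MSOL k
  ¬'_     : MSOL k → MSOL k
  _∧'_ _∨'_ : MSOL k → MSOL k → MSOL k
  ∃₁ ∀₁   : ℕ → MSOL k → MSOL k
  ∃₂ ∀₂   : ℕ → MSOL k → MSOL k

sat : ∀ {k} → MSOL k → (w : Word k) → Assign w → Bool
sat ⊤' w σ = true
sat ⊥' w σ = false
sat (P a x) w σ = isLetter w a (fo σ x)
sat (x ≤' y) w σ = leq {w = w} (fo σ x) (fo σ y)
sat (x ∈' X) w σ = mem {w = w} (fo σ x) (so σ X)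
sat (¬' φ) w σ = not (sat φ w σ)
sat (φ ∧' ψ) w σ = sat φ w σ ∧ sat ψ w σ
sat (φ ∨' ψ) w σ = sat φ w σ ∨ sat ψ w σ
sat (∃₁ x φ) w σ = anyB (λ i → sat φ w (σ [ x ↦₁ i ])) (allPos w)
sat (∀₁ x φ) w σ = allB (λ i → sat φ w (σ [ x ↦₁ i ])) (allPos w)
sat (∃₂ X φ) w σ = anyB (λ A → sat φ w (σ [ X ↦₂ A ])) (allSets w)
sat (∀₂ X φ) w σ = allB (λ A → sat φ w (σ [ X ↦₂ A ])) (allSets w)

data bMSOL (k : ℕ) : Set where
  𝟘 𝟙    : bMSOL k
  P      : Fin k → ℕ → bMSOL k
  _≤'_   : ℕ → ℕ → bMSOL k
  _∈'_   : ℕ → ℕ → bMSOL k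
  ¬'_    : bMSOL k → bMSOL k
  _∧'_   : bMSOL k → bMSOL k → bMSOL k
  ∀₁ ∀₂  : ℕ → bMSOL k → bMSOL k

bsat : ∀ {k} → bMSOL k → (w : Word k) → Assign w → Bool
bsat 𝟘 w σ = false
bsat 𝟙 w σ = true
bsat (P a x) w σ = isLetter w a (fo σ x)
bsat (x ≤' y) w σ = leq {w = w} (fo σ x) (fo σ y)
bsat (x ∈' X) w σ = mem {w = w} (fo σ x) (so σ X)
bsat (¬' φ) w σ = not (bsat φ w σ)
bsat (φ ∧' ψ) w σ = bsat φ w σ ∧ bsat ψ w σ
bsat (∀₁ x φ) w σ = allB (λ i → bsat φ w (σ [ x ↦₁ i ])) (allPos w)
bsat (∀₂ X φ) w σ = allB (λ A → bsat φ w (σ [ X ↦₂ A ])) (allSets w)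

-- RMSOL (over the semiring carrier A and Σ = Fin k): the fragment of
-- WMSOL where ∀X.ψ only for ψ ∈ bMSOL, and ∀x.ψ only for bMSOL-step
-- formulas ψ = ⋁_{i∈I} (φ_i ∧ k_i), given as the finite list of pairs (φ_i , k_i).

data Pair {c} (k : ℕ) (A : Set c) : Set c where
  _,_ : bMSOL k → A → Pair k A

data RMSOL {c} (k : ℕ) (A : Set c) : Set c where
  const    : A → RMSOL k A
  P        : Fin k → ℕ → RMSOL k A
  ¬P       : Fin k → ℕ → RMSOL k A
  _≤'_     : ℕ → ℕ → RMSOL k A
  _≰'_     : ℕ → ℕ → RMSOL k A
  _∈'_     : ℕ → ℕ → RMSOL k A
  _∉'_     : ℕ → ℕ → RMSOL k A
  _∨'_ _∧'_ : RMSOL k A → RMSOL k A → RMSOL k A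
  ∃₁ ∃₂    : ℕ → RMSOL k A → RMSOL k A
  ∀₂b      : ℕ → bMSOL k → RMSOL k A
  ∀₁step   : ℕ → List (Pair k A) → RMSOL k A

module Sem {c ℓ} (S : CommutativeSemiring c ℓ) where
  open CommutativeSemiring S using (Carrier; _+_; _*_; 0#; 1#)

  Σ+ : ∀ {a} {B : Set a} → (B → Carrier) → List B → Carrier
  Σ+ f = foldr (λ x r → f x + r) 0#

  Π* : ∀ {a} {B : Set a} → (B → Carrier) → List B → Carrier
  Π* f = foldr (λ x r → f x * r) 1#

  pow : Carrier → ℕ → Carrier
  pow r zero = 1#
  pow r (suc n) = r * pow r n

  ⟦_⟧ : Bool → Carrier
  ⟦ true ⟧ = 1#
  ⟦ false ⟧ = 0#

  stepVal : ∀ {k} → List (Pair k Carrier) → (w : Word k) → Assign w → Carrier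
  stepVal [] w σ = 0#
  stepVal ((φ , r) ∷ ps) w σ = (⟦ bsat φ w σ ⟧ * r) + stepVal ps w σ

  WE : ∀ {k} → RMSOL k Carrier → (w : Word k) → Assign w → Carrier
  WE (const r) w σ = r
  WE (P a x) w σ = ⟦ isLetter w a (fo σ x) ⟧
  WE (¬P a x) w σ = ⟦ not (isLetter w a (fo σ x)) ⟧
  WE (x ≤' y) w σ = ⟦ leq {w = w} (fo σ x) (fo σ y) ⟧
  WE (x ≰' y) w σ = ⟦ not (leq {w = w} (fo σ x) (fo σ y)) ⟧
  WE (x ∈' X) w σ = ⟦ mem {w = w} (fo σ x) (so σ X) ⟧
  WE (x ∉' X) w σ = ⟦ not (mem {w = w} (fo σ x) (so σ X)) ⟧
  WE (φ ∨' ψ) w σ = WE φ w σ + WE ψ w σ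
  WE (φ ∧' ψ) w σ = WE φ w σ * WE ψ w σ
  WE (∃₁ x φ) w σ = Σ+ (λ i → WE φ w (σ [ x ↦₁ i ])) (allPos w)
  WE (∃₂ X φ) w σ = Σ+ (λ A → WE φ w (σ [ X ↦₂ A ])) (allSets w)
  WE (∀₂b X ψ) w σ = Π* (λ A → ⟦ bsat ψ w (σ [ X ↦₂ A ]) ⟧) (allSets w)
  WE (∀₁step x ps) w σ = Π* (λ i → stepVal ps w (σ [ x ↦₁ i ])) (allPos w)

-- MSOLEVAL_S expressions.
-- Monomial  ∏_{v : φ(v)} r  :  mono v φ r   (v a first-order variable).
-- Expr ::= finite product of monomials | Σ_{R̄ : φ(R̄)} t  (R̄ a tuple of set variables)

data Monomial {c} (k : ℕ) (A : Set c) : Set c where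
  mono : ℕ → MSOL k → A → Monomial k A

data Expr {c} (k : ℕ) (A : Set c) : Set c where
  prod : List (Monomial k A) → Expr k A
  sum  : List ℕ → MSOL k → Expr k A → Expr k A

module Eval {c ℓ} (S : CommutativeSemiring c ℓ) where
  open CommutativeSemiring S using (Carrier; _+_; _*_; 0#; 1#)
  open Sem S using (Σ+; Π*; pow; ⟦_⟧)

  count : ∀ {k} (w : Word k) → (Pos w → Bool) → ℕ
  count w p = foldr (λ i n → if p i then suc n else n) zero (allPos w)

  monoVal : ∀ {k} → Monomial k Carrier → (w : Word k) → Assign w → Carrier
  monoVal (mono v φ r) w σ = pow r (count w (λ i → sat φ w (σ [ v ↦₁ i ])))

  sumTuple : ∀ {k} (w : Word k) → List ℕ → (Assign w → Carrier) → Assign w → Carrier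
  sumTuple w [] f σ = f σ
  sumTuple w (X ∷ Xs) f σ = Σ+ (λ A → sumTuple w Xs f (σ [ X ↦₂ A ])) (allSets w)

  E : ∀ {k} → Expr k Carrier → (w : Word k) → Assign w → Carrier
  E (prod ms) w σ = Π* (λ m → monoVal m w σ) ms
  E (sum Rs φ t) w σ = sumTuple w Rs (λ σ' → ⟦ sat φ w σ' ⟧ * E t w σ') σ

-- Every RMSOL formula is compiled into a normal form: one MSOLEVAL sum over fresh set variables whose
-- summand is a guard formula times a product of monomials. Fresh variables lie above every set variable
-- of the formula, and ∃X renames X to a fresh one. Normal forms over disjoint blocks of variables
-- multiply. For φ ∨ ψ a selector set S ⊆ {0} is summed over: S = ∅ activates φ, S = {0} activates ψ,
-- and the inactive side has its variables forced empty and its monomials guarded down to 1. ∃x sums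
-- over singleton sets, and ∀X.ψ with ψ Boolean becomes part of the guard. Finally ∀x.⋁ᵢ (φᵢ ∧ kᵢ)
-- becomes a sum over the ways of assigning every position to a disjunct i (a set Xᵢ per disjunct),
-- weighted by ∏_{x ∈ Xᵢ} kᵢ: by distributivity, a product over positions of sums is the sum over all
-- such choices of the products.

module Submission where

open import Defs
open import Data.Nat using (ℕ)
open import Data.Product using (Σ)
open import Algebra.Bundles using (CommutativeSemiring)

open import Data.Nat using (zero; suc; _≤_; _<_; _⊔_; _≡ᵇ_; _≤ᵇ_; _<ᵇ_; z<s)
  renaming (_+_ to _+ℕ_; _≟_ to _≟ℕ_)
open import Data.Nat.Properties
  using (≤-refl; ≤-trans; ≤-reflexive; <-irrefl; <⇒≤; m<n⇒m<1+n; n≤1+n; m≤m+n; m<m+n; +-monoʳ-≤;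
         m≤m⊔n; m≤n⊔m; ≡ᵇ⇒≡)
import Data.Nat.Properties as ℕₚ
open import Data.Bool using (Bool; true; false; not; _∧_; _∨_; if_then_else_; T)
open import Data.Bool.Properties using (∨-identityʳ; ∨-zeroʳ; ∧-identityʳ; ∧-zeroʳ)
open import Data.Empty using (⊥-elim)
open import Data.Fin using (Fin; toℕ) renaming (zero to fzero; suc to fsuc)
open import Data.Fin.Subset using (⁅_⁆) renaming (⊥ to ∅)
open import Data.List using (List; []; _∷_; _++_; foldr; map; length; allFin; concatMap)
open import Data.List.Properties using (foldr-cong; foldr-map; map-tabulate)
open import Data.List.Relation.Unary.All using (All; []; _∷_)
import Data.List.Relation.Unary.All as All
open import Data.List.Relation.Unary.All.Properties using (++⁺)
open import Data.Product using (_×_; proj₁; proj₂) renaming (_,_ to _,,_)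
open import Data.Sum using (_⊎_; inj₁; inj₂)
open import Data.Unit using (⊤; tt)
open import Data.Vec using (Vec; []; _∷_) renaming (lookup to vlookup)
open import Function using (id; _∘_)
open import Relation.Nullary using (¬_; yes; no)
open import Relation.Binary.PropositionalEquality
  using (_≡_; _≢_; refl; sym; trans; cong; cong₂; subst; module ≡-Reasoning)

foldr-allFin-suc : ∀ {b} {B : Set b} {n} (f : Fin (suc n) → B → B) (e : B) →
                   foldr f e (allFin (suc n)) ≡ f fzero (foldr (f ∘ fsuc) e (allFin n))
foldr-allFin-suc {n = n} f e =
  cong (f fzero) (trans (cong (foldr f e) (sym (map-tabulate id fsuc))) (foldr-map f fsuc e (allFin n)))

foldr-skip : ∀ {a b} {A : Set a} {B : Set b} {e : B} (xs : List A) → foldr (λ _ y → y) e xs ≡ e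
foldr-skip []       = refl
foldr-skip (x ∷ xs) = foldr-skip xs

anyB-allFin-suc : ∀ {n} (p : Fin (suc n) → Bool) →
                  anyB p (allFin (suc n)) ≡ (p fzero ∨ anyB (p ∘ fsuc) (allFin n))
anyB-allFin-suc p = foldr-allFin-suc (λ i b → p i ∨ b) false

allB-allFin-suc : ∀ {n} (p : Fin (suc n) → Bool) →
                  allB p (allFin (suc n)) ≡ (p fzero ∧ allB (p ∘ fsuc) (allFin n))
allB-allFin-suc p = foldr-allFin-suc (λ i b → p i ∧ b) true

anyB-cong : ∀ {a} {A : Set a} {p q : A → Bool} → (∀ x → p x ≡ q x) → ∀ xs → anyB p xs ≡ anyB q xs
anyB-cong p≗q = foldr-cong (λ x b → cong (_∨ b) (p≗q x)) refl

allB-cong : ∀ {a} {A : Set a} {p q : A → Bool} → (∀ x → p x ≡ q x) → ∀ xs → allB p xs ≡ allB q xs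
allB-cong p≗q = foldr-cong (λ x b → cong (_∧ b) (p≗q x)) refl

allB-true : ∀ {a} {A : Set a} (xs : List A) → allB (λ _ → true) xs ≡ true
allB-true []       = refl
allB-true (x ∷ xs) = allB-true xs

allB-∧ : ∀ {a} {A : Set a} (p q : A → Bool) xs → allB (λ x → p x ∧ q x) xs ≡ (allB p xs ∧ allB q xs)
allB-∧ p q []       = refl
allB-∧ p q (x ∷ xs) with p x | q x
... | true  | true  = allB-∧ p q xs
... | true  | false = sym (∧-zeroʳ _)
... | false | _     = refl

isEmpty : ∀ {n} → Vec Bool n → Bool
isEmpty []      = true
isEmpty (b ∷ V) = not b ∧ isEmpty V

isSingleton : ∀ {n} → Vec Bool n → Bool
isSingleton []      = false
isSingleton (b ∷ V) = if b then isEmpty V else isSingleton V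

isSubsetOf⁅0⁆ : ∀ {n} → Vec Bool (suc n) → Bool
isSubsetOf⁅0⁆ (b ∷ V) = isEmpty V

isEmpty-∅ : ∀ n → isEmpty (∅ {n}) ≡ true
isEmpty-∅ zero    = refl
isEmpty-∅ (suc n) = isEmpty-∅ n

allB-∉ : ∀ {n} (V : Vec Bool n) → allB (λ i → not (vlookup V i)) (allFin n) ≡ isEmpty V
allB-∉ []      = refl
allB-∉ (b ∷ V) = trans (allB-allFin-suc (λ i → not (vlookup (b ∷ V) i))) (cong (not b ∧_) (allB-∉ V))

anyB-∈⁅⁆ : ∀ {n} (p : Fin n) (f : Fin n → Bool) → anyB (λ i → vlookup ⁅ p ⁆ i ∧ f i) (allFin n) ≡ f p
anyB-∈⁅⁆ {suc n} fzero f =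
  trans (anyB-allFin-suc (λ i → vlookup ⁅ fzero ⁆ i ∧ f i))
        (trans (cong (f fzero ∨_) (anyB-∈∅ (f ∘ fsuc))) (∨-identityʳ (f fzero)))
  where
  anyB-∈∅ : ∀ {m} (g : Fin m → Bool) → anyB (λ i → vlookup ∅ i ∧ g i) (allFin m) ≡ false
  anyB-∈∅ {zero}  g = refl
  anyB-∈∅ {suc m} g = trans (anyB-allFin-suc (λ i → vlookup ∅ i ∧ g i)) (anyB-∈∅ (g ∘ fsuc))
anyB-∈⁅⁆ {suc n} (fsuc p) f =
  trans (anyB-allFin-suc (λ i → vlookup ⁅ fsuc p ⁆ i ∧ f i)) (anyB-∈⁅⁆ p (f ∘ fsuc))

private
  <ᵇ-suc : ∀ m n → (m <ᵇ suc n) ≡ (m ≤ᵇ n)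
  <ᵇ-suc zero    n = refl
  <ᵇ-suc (suc m) n = refl

atMostOne : ∀ {n} → Vec Bool n → Bool
atMostOne {n} V =
  allB (λ i → allB (λ j → (not (vlookup V i) ∨ not (vlookup V j)) ∨ (toℕ i ≤ᵇ toℕ j)) (allFin n)) (allFin n)

atMostOne-∷ : ∀ {n} b (V : Vec Bool n) → atMostOne (b ∷ V) ≡ ((if b then isEmpty V else true) ∧ atMostOne V)
atMostOne-∷ {n} b V = begin
  atMostOne (b ∷ V)                                ≡⟨ allB-allFin-suc row ⟩
  row fzero ∧ allB (row ∘ fsuc) (allFin n)         ≡⟨ cong₂ _∧_ row₀ (allB-cong rowₛ (allFin n)) ⟩
  allB (λ i → column b i ∧ pairs i) (allFin n)     ≡⟨ allB-∧ (column b) pairs (allFin n) ⟩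
  allB (column b) (allFin n) ∧ atMostOne V         ≡⟨ cong (_∧ atMostOne V) (allB-column b) ⟩
  (if b then isEmpty V else true) ∧ atMostOne V    ∎
  where
  open ≡-Reasoning
  row : Fin (suc n) → Bool
  row i = allB (λ j → (not (vlookup (b ∷ V) i) ∨ not (vlookup (b ∷ V) j)) ∨ (toℕ i ≤ᵇ toℕ j)) (allFin (suc n))
  pairs : Fin n → Bool
  pairs i = allB (λ j → (not (vlookup V i) ∨ not (vlookup V j)) ∨ (toℕ i ≤ᵇ toℕ j)) (allFin n)
  column : Bool → Fin n → Bool
  column b i = (not (vlookup V i) ∨ not b) ∨ false
  row₀ : row fzero ≡ true
  row₀ = trans (allB-cong (λ j → ∨-zeroʳ _) (allFin (suc n))) (allB-true (allFin (suc n)))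
  rowₛ : ∀ i → row (fsuc i) ≡ (column b i ∧ pairs i)
  rowₛ i =
    trans (allB-allFin-suc (λ j → (not (vlookup V i) ∨ not (vlookup (b ∷ V) j)) ∨ (suc (toℕ i) ≤ᵇ toℕ j)))
          (cong (column b i ∧_)
                (allB-cong (λ j → cong ((not (vlookup V i) ∨ not (vlookup V j)) ∨_) (<ᵇ-suc (toℕ i) (toℕ j)))
                           (allFin n)))
  allB-column : ∀ b → allB (column b) (allFin n) ≡ (if b then isEmpty V else true)
  allB-column true  = trans (allB-cong (λ i → trans (∨-identityʳ _) (∨-identityʳ _)) (allFin n)) (allB-∉ V)
  allB-column false = trans (allB-cong (λ i → trans (∨-identityʳ _) (∨-zeroʳ _)) (allFin n)) (allB-true (allFin n))

isEmpty⇒atMostOne : ∀ {n} (V : Vec Bool n) → isEmpty V ≡ true → atMostOne V ≡ true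
isEmpty⇒atMostOne []          _ = refl
isEmpty⇒atMostOne (false ∷ V) e = trans (atMostOne-∷ false V) (isEmpty⇒atMostOne V e)

nonempty∧atMostOne : ∀ {n} (V : Vec Bool n) → (anyB (vlookup V) (allFin n) ∧ atMostOne V) ≡ isSingleton V
nonempty∧atMostOne []            = refl
nonempty∧atMostOne {suc n} (b ∷ V) =
  trans (cong₂ _∧_ (anyB-allFin-suc (vlookup (b ∷ V))) (atMostOne-∷ b V)) (by-cases b)
  where
  by-cases : ∀ b → ((b ∨ anyB (vlookup V) (allFin n)) ∧ ((if b then isEmpty V else true) ∧ atMostOne V))
                   ≡ isSingleton (b ∷ V)
  by-cases false = nonempty∧atMostOne V
  by-cases true with isEmpty V in e
  ... | false = refl
  ... | true  = isEmpty⇒atMostOne V e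

≡ᵇ-refl : ∀ n → (n ≡ᵇ n) ≡ true
≡ᵇ-refl zero    = refl
≡ᵇ-refl (suc n) = ≡ᵇ-refl n

≡ᵇ-true⇒≡ : ∀ m n → (m ≡ᵇ n) ≡ true → m ≡ n
≡ᵇ-true⇒≡ m n m≡ᵇn = ≡ᵇ⇒≡ m n (subst T (sym m≡ᵇn) tt)

≢⇒≡ᵇ-false : ∀ m n → m ≢ n → (m ≡ᵇ n) ≡ false
≢⇒≡ᵇ-false zero    zero    m≢n = ⊥-elim (m≢n refl)
≢⇒≡ᵇ-false zero    (suc n) m≢n = refl
≢⇒≡ᵇ-false (suc m) zero    m≢n = refl
≢⇒≡ᵇ-false (suc m) (suc n) m≢n = ≢⇒≡ᵇ-false m n (m≢n ∘ cong suc)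

_◃_ : ℕ → (ℕ → Set) → ℕ → Set
(X ◃ Q) Z = Z ≡ X ⊎ Q Z

◃-mono : ∀ {Q Q′ : ℕ → Set} X → (∀ Z → Q Z → Q′ Z) → ∀ Z → (X ◃ Q) Z → (X ◃ Q′) Z
◃-mono X Q⊆Q′ Z (inj₁ Z≡X) = inj₁ Z≡X
◃-mono X Q⊆Q′ Z (inj₂ q)   = inj₂ (Q⊆Q′ Z q)

module _ {k : ℕ} {w : Word k} where

  record Agree (Q : ℕ → Set) (σ τ : Assign w) : Set where
    constructor agree
    field
      fo-agree : ∀ x → fo σ x ≡ fo τ x
      so-agree : ∀ Z → Q Z → so σ Z ≡ so τ Z
  open Agree public

  Agree-refl : ∀ {Q σ} → Agree Q σ σ
  Agree-refl = agree (λ _ → refl) (λ _ _ → refl)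

  Agree-sym : ∀ {Q σ τ} → Agree Q σ τ → Agree Q τ σ
  Agree-sym (agree f s) = agree (λ x → sym (f x)) (λ Z q → sym (s Z q))

  Agree-trans : ∀ {Q σ τ υ} → Agree Q σ τ → Agree Q τ υ → Agree Q σ υ
  Agree-trans (agree f s) (agree f′ s′) = agree (λ x → trans (f x) (f′ x)) (λ Z q → trans (s Z q) (s′ Z q))

  private
    if-congʳ : ∀ {a} {A : Set a} b (t : A) {u v : A} → (b ≡ false → u ≡ v) →
               (if b then t else u) ≡ (if b then t else v)
    if-congʳ true  t _   = refl
    if-congʳ false t u≡v = u≡v refl

  Agree-update₁ : ∀ {Q σ τ} x i → Agree Q σ τ → Agree Q (σ [ x ↦₁ i ]) (τ [ x ↦₁ i ])
  Agree-update₁ x i (agree f s) = agree (λ y → if-congʳ (y ≡ᵇ x) i (λ _ → f y)) s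

  Agree-update₂ : ∀ {Q σ τ} X A → Agree Q σ τ → Agree Q (σ [ X ↦₂ A ]) (τ [ X ↦₂ A ])
  Agree-update₂ X A (agree f s) = agree f (λ Z q → if-congʳ (Z ≡ᵇ X) A (λ _ → s Z q))

  Agree-update₂-◃ : ∀ {Q σ τ} X A → Agree Q σ τ → Agree (X ◃ Q) (σ [ X ↦₂ A ]) (τ [ X ↦₂ A ])
  Agree-update₂-◃ {Q} {σ} {τ} X A (agree f s) = agree f bound
    where
    bound : ∀ Z → (X ◃ Q) Z → so (σ [ X ↦₂ A ]) Z ≡ so (τ [ X ↦₂ A ]) Z
    bound Z (inj₁ refl) rewrite ≡ᵇ-refl Z = refl
    bound Z (inj₂ q)    = if-congʳ (Z ≡ᵇ X) A (λ _ → s Z q)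

  Agree-fresh : ∀ {Q σ} X A → ¬ Q X → Agree Q σ (σ [ X ↦₂ A ])
  Agree-fresh {Q} {σ} X A X∉Q = agree (λ _ → refl) unchanged
    where
    unchanged : ∀ Z → Q Z → so σ Z ≡ (if Z ≡ᵇ X then A else so σ Z)
    unchanged Z q rewrite ≢⇒≡ᵇ-false Z X (λ { refl → X∉Q q }) = refl

  update₁-same : ∀ (σ : Assign w) x i → fo (σ [ x ↦₁ i ]) x ≡ i
  update₁-same σ x i rewrite ≡ᵇ-refl x = refl

  update₂-same : ∀ (σ : Assign w) X A → so (σ [ X ↦₂ A ]) X ≡ A
  update₂-same σ X A rewrite ≡ᵇ-refl X = refl

  update₁-shadow : ∀ (σ : Assign w) x i j y → fo (σ [ x ↦₁ i ] [ x ↦₁ j ]) y ≡ fo (σ [ x ↦₁ j ]) y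
  update₁-shadow σ x i j y with y ≡ᵇ x
  ... | true  = refl
  ... | false = refl

  update₁-comm : ∀ (σ : Assign w) x y i j → x ≢ y → ∀ z →
                 fo (σ [ x ↦₁ i ] [ y ↦₁ j ]) z ≡ fo (σ [ y ↦₁ j ] [ x ↦₁ i ]) z
  update₁-comm σ x y i j x≢y z with z ≡ᵇ y in z≡y | z ≡ᵇ x in z≡x
  ... | true  | true  = ⊥-elim (x≢y (trans (sym (≡ᵇ-true⇒≡ z x z≡x)) (≡ᵇ-true⇒≡ z y z≡y)))
  ... | true  | false = refl
  ... | false | true  = refl
  ... | false | false = refl

SetVarsIn : ∀ {k} → (ℕ → Set) → MSOL k → Set
SetVarsIn Q ⊤'       = ⊤
SetVarsIn Q ⊥'       = ⊤
SetVarsIn Q (P a x)  = ⊤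
SetVarsIn Q (x ≤' y) = ⊤
SetVarsIn Q (x ∈' X) = Q X
SetVarsIn Q (¬' φ)   = SetVarsIn Q φ
SetVarsIn Q (φ ∧' ψ) = SetVarsIn Q φ × SetVarsIn Q ψ
SetVarsIn Q (φ ∨' ψ) = SetVarsIn Q φ × SetVarsIn Q ψ
SetVarsIn Q (∃₁ x φ) = SetVarsIn Q φ
SetVarsIn Q (∀₁ x φ) = SetVarsIn Q φ
SetVarsIn Q (∃₂ X φ) = SetVarsIn (X ◃ Q) φ
SetVarsIn Q (∀₂ X φ) = SetVarsIn (X ◃ Q) φ

SetVarsIn-mono : ∀ {k} {Q Q′ : ℕ → Set} (φ : MSOL k) → (∀ Z → Q Z → Q′ Z) →
                 SetVarsIn Q φ → SetVarsIn Q′ φ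
SetVarsIn-mono ⊤'       Q⊆Q′ h          = tt
SetVarsIn-mono ⊥'       Q⊆Q′ h          = tt
SetVarsIn-mono (P a x)  Q⊆Q′ h          = tt
SetVarsIn-mono (x ≤' y) Q⊆Q′ h          = tt
SetVarsIn-mono (x ∈' X) Q⊆Q′ h          = Q⊆Q′ X h
SetVarsIn-mono (¬' φ)   Q⊆Q′ h          = SetVarsIn-mono φ Q⊆Q′ h
SetVarsIn-mono (φ ∧' ψ) Q⊆Q′ (hφ ,, hψ) = SetVarsIn-mono φ Q⊆Q′ hφ ,, SetVarsIn-mono ψ Q⊆Q′ hψ
SetVarsIn-mono (φ ∨' ψ) Q⊆Q′ (hφ ,, hψ) = SetVarsIn-mono φ Q⊆Q′ hφ ,, SetVarsIn-mono ψ Q⊆Q′ hψ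
SetVarsIn-mono (∃₁ x φ) Q⊆Q′ h          = SetVarsIn-mono φ Q⊆Q′ h
SetVarsIn-mono (∀₁ x φ) Q⊆Q′ h          = SetVarsIn-mono φ Q⊆Q′ h
SetVarsIn-mono (∃₂ X φ) Q⊆Q′ h          = SetVarsIn-mono φ (◃-mono X Q⊆Q′) h
SetVarsIn-mono (∀₂ X φ) Q⊆Q′ h          = SetVarsIn-mono φ (◃-mono X Q⊆Q′) h

SetVarsIn-all : ∀ {k} (φ : MSOL k) → SetVarsIn (λ _ → ⊤) φ
SetVarsIn-all ⊤'       = tt
SetVarsIn-all ⊥'       = tt
SetVarsIn-all (P a x)  = tt
SetVarsIn-all (x ≤' y) = tt
SetVarsIn-all (x ∈' X) = tt
SetVarsIn-all (¬' φ)   = SetVarsIn-all φ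
SetVarsIn-all (φ ∧' ψ) = SetVarsIn-all φ ,, SetVarsIn-all ψ
SetVarsIn-all (φ ∨' ψ) = SetVarsIn-all φ ,, SetVarsIn-all ψ
SetVarsIn-all (∃₁ x φ) = SetVarsIn-all φ
SetVarsIn-all (∀₁ x φ) = SetVarsIn-all φ
SetVarsIn-all (∃₂ X φ) = SetVarsIn-mono φ (λ _ _ → inj₂ tt) (SetVarsIn-all φ)
SetVarsIn-all (∀₂ X φ) = SetVarsIn-mono φ (λ _ _ → inj₂ tt) (SetVarsIn-all φ)

sat-cong : ∀ {k} {w : Word k} {Q} (φ : MSOL k) {σ τ : Assign w} →
           SetVarsIn Q φ → Agree Q σ τ → sat φ w σ ≡ sat φ w τ
sat-cong ⊤'                 h          ag = refl
sat-cong ⊥'                 h          ag = refl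
sat-cong {w = w} (P a x)    h          ag = cong (isLetter w a) (fo-agree ag x)
sat-cong {w = w} (x ≤' y)   h          ag = cong₂ (leq {w = w}) (fo-agree ag x) (fo-agree ag y)
sat-cong {w = w} (x ∈' X)   h          ag = cong₂ (mem {w = w}) (fo-agree ag x) (so-agree ag X h)
sat-cong (¬' φ)             h          ag = cong not (sat-cong φ h ag)
sat-cong (φ ∧' ψ)           (hφ ,, hψ) ag = cong₂ _∧_ (sat-cong φ hφ ag) (sat-cong ψ hψ ag)
sat-cong (φ ∨' ψ)           (hφ ,, hψ) ag = cong₂ _∨_ (sat-cong φ hφ ag) (sat-cong ψ hψ ag)
sat-cong {w = w} (∃₁ x φ)   h          ag = anyB-cong (λ i → sat-cong φ h (Agree-update₁ x i ag)) (allPos w)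
sat-cong {w = w} (∀₁ x φ)   h          ag = allB-cong (λ i → sat-cong φ h (Agree-update₁ x i ag)) (allPos w)
sat-cong {w = w} (∃₂ X φ)   h          ag = anyB-cong (λ A → sat-cong φ h (Agree-update₂-◃ X A ag)) (allSets w)
sat-cong {w = w} (∀₂ X φ)   h          ag = allB-cong (λ A → sat-cong φ h (Agree-update₂-◃ X A ag)) (allSets w)

sat-ext : ∀ {k} {w : Word k} (φ : MSOL k) {σ τ : Assign w} →
          (∀ x → fo σ x ≡ fo τ x) → (∀ X → so σ X ≡ so τ X) → sat φ w σ ≡ sat φ w τ
sat-ext φ fo≗ so≗ = sat-cong φ (SetVarsIn-all φ) (agree fo≗ (λ X _ → so≗ X))

-- Unlike SetVarsIn, this ignores binders: set variables bound inside φ must lie in Q as well.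
SetVarsInᵇ : ∀ {k} → (ℕ → Set) → bMSOL k → Set
SetVarsInᵇ Q 𝟘        = ⊤
SetVarsInᵇ Q 𝟙        = ⊤
SetVarsInᵇ Q (P a x)  = ⊤
SetVarsInᵇ Q (x ≤' y) = ⊤
SetVarsInᵇ Q (x ∈' X) = Q X
SetVarsInᵇ Q (¬' φ)   = SetVarsInᵇ Q φ
SetVarsInᵇ Q (φ ∧' ψ) = SetVarsInᵇ Q φ × SetVarsInᵇ Q ψ
SetVarsInᵇ Q (∀₁ x φ) = SetVarsInᵇ Q φ
SetVarsInᵇ Q (∀₂ X φ) = SetVarsInᵇ Q φ

SetVarsInᵇ-mono : ∀ {k} {Q Q′ : ℕ → Set} (φ : bMSOL k) → (∀ Z → Q Z → Q′ Z) →
                  SetVarsInᵇ Q φ → SetVarsInᵇ Q′ φ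
SetVarsInᵇ-mono 𝟘        Q⊆Q′ h          = tt
SetVarsInᵇ-mono 𝟙        Q⊆Q′ h          = tt
SetVarsInᵇ-mono (P a x)  Q⊆Q′ h          = tt
SetVarsInᵇ-mono (x ≤' y) Q⊆Q′ h          = tt
SetVarsInᵇ-mono (x ∈' X) Q⊆Q′ h          = Q⊆Q′ X h
SetVarsInᵇ-mono (¬' φ)   Q⊆Q′ h          = SetVarsInᵇ-mono φ Q⊆Q′ h
SetVarsInᵇ-mono (φ ∧' ψ) Q⊆Q′ (hφ ,, hψ) = SetVarsInᵇ-mono φ Q⊆Q′ hφ ,, SetVarsInᵇ-mono ψ Q⊆Q′ hψ
SetVarsInᵇ-mono (∀₁ x φ) Q⊆Q′ h          = SetVarsInᵇ-mono φ Q⊆Q′ h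
SetVarsInᵇ-mono (∀₂ X φ) Q⊆Q′ h          = SetVarsInᵇ-mono φ Q⊆Q′ h

bsat-cong : ∀ {k} {w : Word k} {Q} (φ : bMSOL k) {σ τ : Assign w} →
            SetVarsInᵇ Q φ → Agree Q σ τ → bsat φ w σ ≡ bsat φ w τ
bsat-cong 𝟘                 h          ag = refl
bsat-cong 𝟙                 h          ag = refl
bsat-cong {w = w} (P a x)   h          ag = cong (isLetter w a) (fo-agree ag x)
bsat-cong {w = w} (x ≤' y)  h          ag = cong₂ (leq {w = w}) (fo-agree ag x) (fo-agree ag y)
bsat-cong {w = w} (x ∈' X)  h          ag = cong₂ (mem {w = w}) (fo-agree ag x) (so-agree ag X h)
bsat-cong (¬' φ)            h          ag = cong not (bsat-cong φ h ag)
bsat-cong (φ ∧' ψ)          (hφ ,, hψ) ag = cong₂ _∧_ (bsat-cong φ hφ ag) (bsat-cong ψ hψ ag)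
bsat-cong {w = w} (∀₁ x φ)  h          ag = allB-cong (λ i → bsat-cong φ h (Agree-update₁ x i ag)) (allPos w)
bsat-cong {w = w} (∀₂ X φ)  h          ag = allB-cong (λ A → bsat-cong φ h (Agree-update₂ X A ag)) (allSets w)

SetVarsInˢ : ∀ {c k} {A : Set c} → (ℕ → Set) → List (Pair k A) → Set
SetVarsInˢ Q []             = ⊤
SetVarsInˢ Q ((φ , r) ∷ ps) = SetVarsInᵇ Q φ × SetVarsInˢ Q ps

SetVarsInʳ : ∀ {c k} {A : Set c} → (ℕ → Set) → RMSOL k A → Set
SetVarsInʳ Q (const r)     = ⊤
SetVarsInʳ Q (P a x)       = ⊤
SetVarsInʳ Q (¬P a x)      = ⊤
SetVarsInʳ Q (x ≤' y)      = ⊤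
SetVarsInʳ Q (x ≰' y)      = ⊤
SetVarsInʳ Q (x ∈' X)      = Q X
SetVarsInʳ Q (x ∉' X)      = Q X
SetVarsInʳ Q (φ ∨' ψ)      = SetVarsInʳ Q φ × SetVarsInʳ Q ψ
SetVarsInʳ Q (φ ∧' ψ)      = SetVarsInʳ Q φ × SetVarsInʳ Q ψ
SetVarsInʳ Q (∃₁ x φ)      = SetVarsInʳ Q φ
SetVarsInʳ Q (∃₂ X φ)      = SetVarsInʳ Q φ
SetVarsInʳ Q (∀₂b X ψ)     = SetVarsInᵇ Q ψ
SetVarsInʳ Q (∀₁step x ps) = SetVarsInˢ Q ps

SetVarsInˢ-mono : ∀ {c k} {A : Set c} {Q Q′ : ℕ → Set} (ps : List (Pair k A)) →
                  (∀ Z → Q Z → Q′ Z) → SetVarsInˢ Q ps → SetVarsInˢ Q′ ps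
SetVarsInˢ-mono []             Q⊆Q′ h          = tt
SetVarsInˢ-mono ((φ , r) ∷ ps) Q⊆Q′ (hφ ,, hs) =
  SetVarsInᵇ-mono φ Q⊆Q′ hφ ,, SetVarsInˢ-mono ps Q⊆Q′ hs

SetVarsInʳ-mono : ∀ {c k} {A : Set c} {Q Q′ : ℕ → Set} (φ : RMSOL k A) →
                  (∀ Z → Q Z → Q′ Z) → SetVarsInʳ Q φ → SetVarsInʳ Q′ φ
SetVarsInʳ-mono (const r)     Q⊆Q′ h          = tt
SetVarsInʳ-mono (P a x)       Q⊆Q′ h          = tt
SetVarsInʳ-mono (¬P a x)      Q⊆Q′ h          = tt
SetVarsInʳ-mono (x ≤' y)      Q⊆Q′ h          = tt
SetVarsInʳ-mono (x ≰' y)      Q⊆Q′ h          = tt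
SetVarsInʳ-mono (x ∈' X)      Q⊆Q′ h          = Q⊆Q′ X h
SetVarsInʳ-mono (x ∉' X)      Q⊆Q′ h          = Q⊆Q′ X h
SetVarsInʳ-mono (φ ∨' ψ)      Q⊆Q′ (hφ ,, hψ) =
  SetVarsInʳ-mono φ Q⊆Q′ hφ ,, SetVarsInʳ-mono ψ Q⊆Q′ hψ
SetVarsInʳ-mono (φ ∧' ψ)      Q⊆Q′ (hφ ,, hψ) =
  SetVarsInʳ-mono φ Q⊆Q′ hφ ,, SetVarsInʳ-mono ψ Q⊆Q′ hψ
SetVarsInʳ-mono (∃₁ x φ)      Q⊆Q′ h          = SetVarsInʳ-mono φ Q⊆Q′ h
SetVarsInʳ-mono (∃₂ X φ)      Q⊆Q′ h          = SetVarsInʳ-mono φ Q⊆Q′ h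
SetVarsInʳ-mono (∀₂b X ψ)     Q⊆Q′ h          = SetVarsInᵇ-mono ψ Q⊆Q′ h
SetVarsInʳ-mono (∀₁step x ps) Q⊆Q′ h          = SetVarsInˢ-mono ps Q⊆Q′ h

setVarBoundᵇ : ∀ {k} → bMSOL k → ℕ
setVarBoundᵇ (x ∈' X) = suc X
setVarBoundᵇ (¬' φ)   = setVarBoundᵇ φ
setVarBoundᵇ (φ ∧' ψ) = setVarBoundᵇ φ ⊔ setVarBoundᵇ ψ
setVarBoundᵇ (∀₁ x φ) = setVarBoundᵇ φ
setVarBoundᵇ (∀₂ X φ) = setVarBoundᵇ φ
setVarBoundᵇ _        = 0

setVarBoundˢ : ∀ {c k} {A : Set c} → List (Pair k A) → ℕ
setVarBoundˢ []             = 0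
setVarBoundˢ ((φ , r) ∷ ps) = setVarBoundᵇ φ ⊔ setVarBoundˢ ps

setVarBoundʳ : ∀ {c k} {A : Set c} → RMSOL k A → ℕ
setVarBoundʳ (x ∈' X)      = suc X
setVarBoundʳ (x ∉' X)      = suc X
setVarBoundʳ (φ ∨' ψ)      = setVarBoundʳ φ ⊔ setVarBoundʳ ψ
setVarBoundʳ (φ ∧' ψ)      = setVarBoundʳ φ ⊔ setVarBoundʳ ψ
setVarBoundʳ (∃₁ x φ)      = setVarBoundʳ φ
setVarBoundʳ (∃₂ X φ)      = setVarBoundʳ φ
setVarBoundʳ (∀₂b X ψ)     = setVarBoundᵇ ψ
setVarBoundʳ (∀₁step x ps) = setVarBoundˢ ps
setVarBoundʳ _             = 0

private
  <-⊔ˡ : ∀ {Z} a b → Z < a → Z < a ⊔ b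
  <-⊔ˡ a b Z<a = ≤-trans Z<a (m≤m⊔n a b)

  <-⊔ʳ : ∀ {Z} a b → Z < b → Z < a ⊔ b
  <-⊔ʳ a b Z<b = ≤-trans Z<b (m≤n⊔m a b)

SetVarsInᵇ-< : ∀ {k} (φ : bMSOL k) → SetVarsInᵇ (_< setVarBoundᵇ φ) φ
SetVarsInᵇ-< 𝟘        = tt
SetVarsInᵇ-< 𝟙        = tt
SetVarsInᵇ-< (P a x)  = tt
SetVarsInᵇ-< (x ≤' y) = tt
SetVarsInᵇ-< (x ∈' X) = ≤-refl
SetVarsInᵇ-< (¬' φ)   = SetVarsInᵇ-< φ
SetVarsInᵇ-< (φ ∧' ψ) = SetVarsInᵇ-mono φ (λ _ → <-⊔ˡ _ _) (SetVarsInᵇ-< φ)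
                     ,, SetVarsInᵇ-mono ψ (λ _ → <-⊔ʳ _ _) (SetVarsInᵇ-< ψ)
SetVarsInᵇ-< (∀₁ x φ) = SetVarsInᵇ-< φ
SetVarsInᵇ-< (∀₂ X φ) = SetVarsInᵇ-< φ

SetVarsInˢ-< : ∀ {c k} {A : Set c} (ps : List (Pair k A)) → SetVarsInˢ (_< setVarBoundˢ ps) ps
SetVarsInˢ-< []             = tt
SetVarsInˢ-< ((φ , r) ∷ ps) = SetVarsInᵇ-mono φ (λ _ → <-⊔ˡ _ _) (SetVarsInᵇ-< φ)
                           ,, SetVarsInˢ-mono ps (λ _ → <-⊔ʳ (setVarBoundᵇ φ) _) (SetVarsInˢ-< ps)

SetVarsInʳ-< : ∀ {c k} {A : Set c} (φ : RMSOL k A) → SetVarsInʳ (_< setVarBoundʳ φ) φ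
SetVarsInʳ-< (const r)     = tt
SetVarsInʳ-< (P a x)       = tt
SetVarsInʳ-< (¬P a x)      = tt
SetVarsInʳ-< (x ≤' y)      = tt
SetVarsInʳ-< (x ≰' y)      = tt
SetVarsInʳ-< (x ∈' X)      = ≤-refl
SetVarsInʳ-< (x ∉' X)      = ≤-refl
SetVarsInʳ-< (φ ∨' ψ)      = SetVarsInʳ-mono φ (λ _ → <-⊔ˡ _ _) (SetVarsInʳ-< φ)
                          ,, SetVarsInʳ-mono ψ (λ _ → <-⊔ʳ (setVarBoundʳ φ) _) (SetVarsInʳ-< ψ)
SetVarsInʳ-< (φ ∧' ψ)      = SetVarsInʳ-mono φ (λ _ → <-⊔ˡ _ _) (SetVarsInʳ-< φ)
                          ,, SetVarsInʳ-mono ψ (λ _ → <-⊔ʳ (setVarBoundʳ φ) _) (SetVarsInʳ-< ψ)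
SetVarsInʳ-< (∃₁ x φ)      = SetVarsInʳ-< φ
SetVarsInʳ-< (∃₂ X φ)      = SetVarsInʳ-< φ
SetVarsInʳ-< (∀₂b X ψ)     = SetVarsInᵇ-< ψ
SetVarsInʳ-< (∀₁step x ps) = SetVarsInˢ-< ps

Below : (ℕ → Set) → ℕ → Set
Below Q n = ∀ Z → Q Z → Z < n

Below-◃ : ∀ {Q} b → Below Q b → Below (b ◃ Q) (suc b)
Below-◃ b Q<b Z (inj₁ refl) = ≤-refl
Below-◃ b Q<b Z (inj₂ q)    = m<n⇒m<1+n (Q<b Z q)

_[_≔_] : (ℕ → ℕ) → ℕ → ℕ → ℕ → ℕ
(ρ [ X ≔ n ]) Z = if Z ≡ᵇ X then n else ρ Z

[≔]-◃ : ∀ (Q : ℕ → Set) ρ X n Z → Q (ρ Z) → (n ◃ Q) ((ρ [ X ≔ n ]) Z)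
[≔]-◃ Q ρ X n Z q with Z ≡ᵇ X
... | true  = inj₁ refl
... | false = inj₂ q

module _ {k : ℕ} {w : Word k} where

  renameSets : Assign w → (ℕ → ℕ) → Assign w
  renameSets σ ρ = ⟨ fo σ , so σ ∘ ρ ⟩

  renameSets-cong : ∀ {Q Q′ : ℕ → Set} ρ {σ τ : Assign w} → (∀ Z → Q′ Z → Q (ρ Z)) →
                    Agree Q σ τ → Agree Q′ (renameSets σ ρ) (renameSets τ ρ)
  renameSets-cong ρ Q′⊆Q∘ρ (agree f s) = agree f (λ Z q → s (ρ Z) (Q′⊆Q∘ρ Z q))

  renameSets-update : ∀ (Q : ℕ → Set) ρ n X (σ : Assign w) A → Below Q n →
                      Agree (Q ∘ ρ) (renameSets (σ [ n ↦₂ A ]) (ρ [ X ≔ n ])) (renameSets σ ρ [ X ↦₂ A ])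
  renameSets-update Q ρ n X σ A Q<n = agree (λ _ → refl) same
    where
    same : ∀ Z → Q (ρ Z) → so (σ [ n ↦₂ A ]) ((ρ [ X ≔ n ]) Z) ≡ (if Z ≡ᵇ X then A else so σ (ρ Z))
    same Z q with Z ≡ᵇ X
    ... | true  rewrite ≡ᵇ-refl n = refl
    ... | false rewrite ≢⇒≡ᵇ-false (ρ Z) n (λ ρZ≡n → <-irrefl ρZ≡n (Q<n (ρ Z) q)) = refl

range : ℕ → ℕ → List ℕ
range n zero    = []
range n (suc d) = n ∷ range (suc n) d

range-++ : ∀ n d₁ d₂ → range n (d₁ +ℕ d₂) ≡ range n d₁ ++ range (n +ℕ d₁) d₂
range-++ n zero     d₂ = cong (λ m → range m d₂) (sym (ℕₚ.+-identityʳ n))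
range-++ n (suc d₁) d₂ =
  cong (n ∷_) (trans (range-++ (suc n) d₁ d₂)
                     (cong (λ m → range (suc n) d₁ ++ range m d₂) (sym (ℕₚ.+-suc n d₁))))

Fresh : (ℕ → Set) → List ℕ → Set
Fresh Q = All (¬_ ∘ Q)

range-fresh : ∀ {Q : ℕ → Set} n d → (∀ Z → Q Z → Z < n ⊎ n +ℕ d ≤ Z) → Fresh Q (range n d)
range-fresh         n zero    outside = []
range-fresh {Q = Q} n (suc d) outside = n∉Q ∷ range-fresh (suc n) d outside′
  where
  n∉Q : ¬ Q n
  n∉Q q with outside n q
  ... | inj₁ n<n     = <-irrefl refl n<n
  ... | inj₂ n+1+d≤n = <-irrefl refl (≤-trans (m<m+n n z<s) n+1+d≤n)
  outside′ : ∀ Z → Q Z → Z < suc n ⊎ suc n +ℕ d ≤ Z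
  outside′ Z q with outside Z q
  ... | inj₁ Z<n     = inj₁ (m<n⇒m<1+n Z<n)
  ... | inj₂ n+1+d≤Z = inj₂ (≤-trans (≤-reflexive (sym (ℕₚ.+-suc n d))) n+1+d≤Z)

data InScope (Q : ℕ → Set) (n d : ℕ) (Z : ℕ) : Set where
  free   : Q Z → InScope Q n d Z
  window : n ≤ Z → Z < n +ℕ d → InScope Q n d Z

InScope-base : ∀ {Q : ℕ → Set} n d → InScope Q n (suc d) n
InScope-base n d = window ≤-refl (m<m+n n z<s)

InScope-suc : ∀ {Q : ℕ → Set} n d {Z} → InScope Q (suc n) d Z → InScope Q n (suc d) Z
InScope-suc n d (free q)        = free q
InScope-suc n d (window n<Z Z<) = window (<⇒≤ n<Z) (≤-trans Z< (≤-reflexive (sym (ℕₚ.+-suc n d))))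

InScope-+ˡ : ∀ {Q : ℕ → Set} n d₁ d₂ {Z} → InScope Q n d₁ Z → InScope Q n (d₁ +ℕ d₂) Z
InScope-+ˡ n d₁ d₂ (free q)        = free q
InScope-+ˡ n d₁ d₂ (window n≤Z Z<) = window n≤Z (≤-trans Z< (+-monoʳ-≤ n (m≤m+n d₁ d₂)))

InScope-+ʳ : ∀ {Q : ℕ → Set} n d₁ d₂ {Z} → InScope Q (n +ℕ d₁) d₂ Z → InScope Q n (d₁ +ℕ d₂) Z
InScope-+ʳ n d₁ d₂ (free q)        = free q
InScope-+ʳ n d₁ d₂ (window n≤Z Z<) =
  window (≤-trans (m≤m+n n d₁) n≤Z) (≤-trans Z< (≤-reflexive (ℕₚ.+-assoc n d₁ d₂)))

InScope-below : ∀ {Q : ℕ → Set} {n m} d → Below Q n → n ≤ m → Below (InScope Q m d) (m +ℕ d)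
InScope-below {m = m} d Q<n n≤m Z (free q)           = ≤-trans (Q<n Z q) (≤-trans n≤m (m≤m+n m d))
InScope-below         d Q<n n≤m Z (window m≤Z Z<m+d) = Z<m+d

InScope-fresh : ∀ {Q : ℕ → Set} {n m} d d′ → Below Q n → n +ℕ d ≤ m → Fresh (InScope Q m d′) (range n d)
InScope-fresh {Q} {n} {m} d d′ Q<n n+d≤m = range-fresh n d outside
  where
  outside : ∀ Z → InScope Q m d′ Z → Z < n ⊎ n +ℕ d ≤ Z
  outside Z (free q)           = inj₁ (Q<n Z q)
  outside Z (window m≤Z Z<m+d) = inj₂ (≤-trans n+d≤m m≤Z)

∉-InScope-suc : ∀ {Q : ℕ → Set} {n} d → Below Q n → ¬ InScope Q (suc n) d n
∉-InScope-suc {n = n} d Q<n (free q)     = <-irrefl refl (Q<n n q)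
∉-InScope-suc         d Q<n (window n<n _) = <-irrefl refl n<n

Below-fresh-range : ∀ {Q : ℕ → Set} n d → Below Q n → Fresh Q (range n d)
Below-fresh-range n d Q<n = range-fresh n d (λ Z q → inj₁ (Q<n Z q))

range-suc-fresh : ∀ n d → Fresh (_≡ n) (range (suc n) d)
range-suc-fresh n d = range-fresh (suc n) d (λ { Z refl → inj₁ ≤-refl })

module _ {k : ℕ} where

  Empty : ℕ → MSOL k
  Empty Y = ∀₁ 0 (¬' (0 ∈' Y))

  SubsetOf⁅0⁆ : ℕ → MSOL k
  SubsetOf⁅0⁆ Y = ∀₁ 0 ((¬' (0 ∈' Y)) ∨' ∀₁ 1 (0 ≤' 1))

  Singleton : ℕ → MSOL k
  Singleton Y = ∃₁ 0 (0 ∈' Y) ∧' ∀₁ 0 (∀₁ 1 (((¬' (0 ∈' Y)) ∨' (¬' (1 ∈' Y))) ∨' (0 ≤' 1)))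

  AllEmpty : List ℕ → MSOL k
  AllEmpty []       = ⊤'
  AllEmpty (Y ∷ Ys) = Empty Y ∧' AllEmpty Ys

  sat-Empty : ∀ {w : Word k} Y (σ : Assign w) → sat (Empty Y) w σ ≡ isEmpty (so σ Y)
  sat-Empty Y σ = allB-∉ (so σ Y)

  sat-SubsetOf⁅0⁆ : ∀ {w : Word k} Y (σ : Assign w) → sat (SubsetOf⁅0⁆ Y) w σ ≡ isSubsetOf⁅0⁆ (so σ Y)
  sat-SubsetOf⁅0⁆ Y σ = lemma (so σ Y)
    where
    lemma : ∀ {n} (V : Vec Bool (suc n)) →
            allB (λ i → not (vlookup V i) ∨ allB (λ j → toℕ i ≤ᵇ toℕ j) (allFin (suc n))) (allFin (suc n))
            ≡ isSubsetOf⁅0⁆ V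
    lemma {n} (b ∷ V) =
      trans (allB-allFin-suc (λ i → not (vlookup (b ∷ V) i) ∨ allB (λ j → toℕ i ≤ᵇ toℕ j) (allFin (suc n))))
            (cong₂ _∧_ (trans (cong (not b ∨_) (allB-true (allFin (suc n)))) (∨-zeroʳ (not b)))
                       (trans (allB-cong (λ i → ∨-identityʳ (not (vlookup V i))) (allFin n)) (allB-∉ V)))

  sat-Singleton : ∀ {w : Word k} Y (σ : Assign w) → sat (Singleton Y) w σ ≡ isSingleton (so σ Y)
  sat-Singleton Y σ = nonempty∧atMostOne (so σ Y)

  SetVarsIn-AllEmpty : ∀ {Q : ℕ → Set} m d → SetVarsIn (InScope Q m d) (AllEmpty (range m d))
  SetVarsIn-AllEmpty m zero    = tt
  SetVarsIn-AllEmpty m (suc d) =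
    InScope-base m d
    ,, SetVarsIn-mono (AllEmpty (range (suc m) d)) (λ Z → InScope-suc m d) (SetVarsIn-AllEmpty (suc m) d)

  sat-∃∈⁅⁆ : ∀ {w : Word k} (σ : Assign w) x Y p ψ → so σ Y ≡ ⁅ p ⁆ →
             sat (∃₁ x ((x ∈' Y) ∧' ψ)) w σ ≡ sat ψ w (σ [ x ↦₁ p ])
  sat-∃∈⁅⁆ {w} σ x Y p ψ σY≡⁅p⁆ =
    trans (anyB-cong (λ j → cong (_∧ sat ψ w (σ [ x ↦₁ j ]))
                                 (cong₂ (λ i V → vlookup V i) (update₁-same σ x j) σY≡⁅p⁆))
                     (allPos w))
          (anyB-∈⁅⁆ p (λ j → sat ψ w (σ [ x ↦₁ j ])))

module _ {k : ℕ} where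

  translateᵇ : bMSOL k → (ℕ → ℕ) → ℕ → MSOL k
  translateᵇ 𝟘        ρ b = ⊥'
  translateᵇ 𝟙        ρ b = ⊤'
  translateᵇ (P a x)  ρ b = P a x
  translateᵇ (x ≤' y) ρ b = x ≤' y
  translateᵇ (x ∈' X) ρ b = x ∈' ρ X
  translateᵇ (¬' φ)   ρ b = ¬' translateᵇ φ ρ b
  translateᵇ (φ ∧' ψ) ρ b = translateᵇ φ ρ b ∧' translateᵇ ψ ρ b
  translateᵇ (∀₁ x φ) ρ b = ∀₁ x (translateᵇ φ ρ b)
  translateᵇ (∀₂ X φ) ρ b = ∀₂ b (translateᵇ φ (ρ [ X ≔ b ]) (suc b))

  SetVarsIn-translateᵇ : ∀ (Q : ℕ → Set) ρ b (φ : bMSOL k) →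
                         SetVarsInᵇ (Q ∘ ρ) φ → SetVarsIn Q (translateᵇ φ ρ b)
  SetVarsIn-translateᵇ Q ρ b 𝟘        h          = tt
  SetVarsIn-translateᵇ Q ρ b 𝟙        h          = tt
  SetVarsIn-translateᵇ Q ρ b (P a x)  h          = tt
  SetVarsIn-translateᵇ Q ρ b (x ≤' y) h          = tt
  SetVarsIn-translateᵇ Q ρ b (x ∈' X) h          = h
  SetVarsIn-translateᵇ Q ρ b (¬' φ)   h          = SetVarsIn-translateᵇ Q ρ b φ h
  SetVarsIn-translateᵇ Q ρ b (φ ∧' ψ) (hφ ,, hψ) =
    SetVarsIn-translateᵇ Q ρ b φ hφ ,, SetVarsIn-translateᵇ Q ρ b ψ hψ
  SetVarsIn-translateᵇ Q ρ b (∀₁ x φ) h          = SetVarsIn-translateᵇ Q ρ b φ h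
  SetVarsIn-translateᵇ Q ρ b (∀₂ X φ) h          =
    SetVarsIn-translateᵇ (b ◃ Q) (ρ [ X ≔ b ]) (suc b) φ (SetVarsInᵇ-mono φ ([≔]-◃ Q ρ X b) h)

  sat-translateᵇ : ∀ {w : Word k} (Q : ℕ → Set) ρ b → Below Q b → (φ : bMSOL k) →
                   SetVarsInᵇ (Q ∘ ρ) φ → ∀ (σ : Assign w) →
                   sat (translateᵇ φ ρ b) w σ ≡ bsat φ w (renameSets σ ρ)
  sat-translateᵇ Q ρ b Q<b 𝟘        h          σ = refl
  sat-translateᵇ Q ρ b Q<b 𝟙        h          σ = refl
  sat-translateᵇ Q ρ b Q<b (P a x)  h          σ = refl
  sat-translateᵇ Q ρ b Q<b (x ≤' y) h          σ = refl
  sat-translateᵇ Q ρ b Q<b (x ∈' X) h          σ = refl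
  sat-translateᵇ Q ρ b Q<b (¬' φ)   h          σ = cong not (sat-translateᵇ Q ρ b Q<b φ h σ)
  sat-translateᵇ Q ρ b Q<b (φ ∧' ψ) (hφ ,, hψ) σ =
    cong₂ _∧_ (sat-translateᵇ Q ρ b Q<b φ hφ σ) (sat-translateᵇ Q ρ b Q<b ψ hψ σ)
  sat-translateᵇ {w} Q ρ b Q<b (∀₁ x φ) h σ =
    allB-cong (λ i → sat-translateᵇ Q ρ b Q<b φ h (σ [ x ↦₁ i ])) (allPos w)
  sat-translateᵇ {w} Q ρ b Q<b (∀₂ X φ) h σ = allB-cong body (allSets w)
    where
    body : ∀ A → sat (translateᵇ φ (ρ [ X ≔ b ]) (suc b)) w (σ [ b ↦₂ A ])
                 ≡ bsat φ w (renameSets σ ρ [ X ↦₂ A ])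
    body A = trans (sat-translateᵇ (b ◃ Q) (ρ [ X ≔ b ]) (suc b) (Below-◃ b Q<b) φ
                     (SetVarsInᵇ-mono φ ([≔]-◃ Q ρ X b) h) (σ [ b ↦₂ A ]))
                   (bsat-cong φ h (renameSets-update Q ρ b X σ A Q<b))

module Sums {c ℓ} (S : CommutativeSemiring c ℓ) where
  open CommutativeSemiring S hiding (zero) renaming (refl to ≈-refl; sym to ≈-sym; trans to ≈-trans)
  open Sem S using (Σ+; Π*; pow; ⟦_⟧)
  open import Algebra.Properties.CommutativeSemigroup +-commutativeSemigroup
    using () renaming (interchange to +-interchange)
  open import Algebra.Properties.CommutativeSemigroup *-commutativeSemigroup
    using () renaming (interchange to *-interchange) public
  open import Relation.Binary.Reasoning.Setoid setoid

  Σ+-cong : ∀ {a} {A : Set a} {f g : A → Carrier} → (∀ x → f x ≈ g x) → ∀ xs → Σ+ f xs ≈ Σ+ g xs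
  Σ+-cong f≈g []       = ≈-refl
  Σ+-cong f≈g (x ∷ xs) = +-cong (f≈g x) (Σ+-cong f≈g xs)

  Π*-cong : ∀ {a} {A : Set a} {f g : A → Carrier} → (∀ x → f x ≈ g x) → ∀ xs → Π* f xs ≈ Π* g xs
  Π*-cong f≈g []       = ≈-refl
  Π*-cong f≈g (x ∷ xs) = *-cong (f≈g x) (Π*-cong f≈g xs)

  Σ+-+ : ∀ {a} {A : Set a} (f g : A → Carrier) xs → Σ+ (λ x → f x + g x) xs ≈ Σ+ f xs + Σ+ g xs
  Σ+-+ f g []       = ≈-sym (+-identityˡ 0#)
  Σ+-+ f g (x ∷ xs) = ≈-trans (+-congˡ (Σ+-+ f g xs)) (+-interchange _ _ _ _)

  Π*-* : ∀ {a} {A : Set a} (f g : A → Carrier) xs → Π* (λ x → f x * g x) xs ≈ Π* f xs * Π* g xs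
  Π*-* f g []       = ≈-sym (*-identityˡ 1#)
  Π*-* f g (x ∷ xs) = ≈-trans (*-congˡ (Π*-* f g xs)) (*-interchange _ _ _ _)

  Σ+-distribˡ : ∀ {a} {A : Set a} (r : Carrier) (f : A → Carrier) xs → Σ+ (λ x → r * f x) xs ≈ r * Σ+ f xs
  Σ+-distribˡ r f []       = ≈-sym (zeroʳ r)
  Σ+-distribˡ r f (x ∷ xs) = ≈-trans (+-congˡ (Σ+-distribˡ r f xs)) (≈-sym (distribˡ r (f x) _))

  Σ+-allFin-suc : ∀ {n} (f : Fin (suc n) → Carrier) →
                  Σ+ f (allFin (suc n)) ≈ f fzero + Σ+ (f ∘ fsuc) (allFin n)
  Σ+-allFin-suc f = reflexive (foldr-allFin-suc (λ i r → f i + r) 0#)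

  Π*-allFin-suc : ∀ {n} (f : Fin (suc n) → Carrier) →
                  Π* f (allFin (suc n)) ≈ f fzero * Π* (f ∘ fsuc) (allFin n)
  Π*-allFin-suc f = reflexive (foldr-allFin-suc (λ i r → f i * r) 1#)

  ⟦∧⟧ : ∀ a b → ⟦ a ∧ b ⟧ ≈ ⟦ a ⟧ * ⟦ b ⟧
  ⟦∧⟧ true  b = ≈-sym (*-identityˡ _)
  ⟦∧⟧ false b = ≈-sym (zeroˡ _)

  ⟦allB⟧ : ∀ {a} {A : Set a} (p : A → Bool) xs → ⟦ allB p xs ⟧ ≈ Π* (⟦_⟧ ∘ p) xs
  ⟦allB⟧ p []       = ≈-refl
  ⟦allB⟧ p (x ∷ xs) = ≈-trans (⟦∧⟧ (p x) _) (*-congˡ (⟦allB⟧ p xs))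

  pow-count : ∀ {a} {A : Set a} (r : Carrier) (p : A → Bool) xs →
              pow r (foldr (λ x n → if p x then suc n else n) zero xs) ≈ Π* (λ x → if p x then r else 1#) xs
  pow-count r p []       = ≈-refl
  pow-count r p (x ∷ xs) with p x
  ... | true  = *-congˡ (pow-count r p xs)
  ... | false = ≈-trans (pow-count r p xs) (≈-sym (*-identityˡ _))

  Σ+-allVecs-suc : ∀ {n} (f : Vec Bool (suc n) → Carrier) →
                   Σ+ f (allVecs (suc n)) ≈ Σ+ (λ V → f (false ∷ V) + f (true ∷ V)) (allVecs n)
  Σ+-allVecs-suc {n} f = go (allVecs n)
    where
    go : ∀ Vs → Σ+ f (concatMap (λ V → (false ∷ V) ∷ (true ∷ V) ∷ []) Vs)
                ≈ Σ+ (λ V → f (false ∷ V) + f (true ∷ V)) Vs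
    go []       = ≈-refl
    go (V ∷ Vs) = ≈-trans (+-congˡ (+-congˡ (go Vs))) (≈-sym (+-assoc _ _ _))

  Σ-isEmpty : ∀ n (g : Vec Bool n → Carrier) → Σ+ (λ V → ⟦ isEmpty V ⟧ * g V) (allVecs n) ≈ g ∅
  Σ-isEmpty zero    g = ≈-trans (+-identityʳ _) (*-identityˡ _)
  Σ-isEmpty (suc n) g = begin
    Σ+ (λ V → ⟦ isEmpty V ⟧ * g V) (allVecs (suc n))
      ≈⟨ Σ+-allVecs-suc (λ V → ⟦ isEmpty V ⟧ * g V) ⟩
    Σ+ (λ V → ⟦ isEmpty V ⟧ * g (false ∷ V) + 0# * g (true ∷ V)) (allVecs n)
      ≈⟨ Σ+-cong (λ V → ≈-trans (+-congˡ (zeroˡ _)) (+-identityʳ _)) (allVecs n) ⟩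
    Σ+ (λ V → ⟦ isEmpty V ⟧ * g (false ∷ V)) (allVecs n)
      ≈⟨ Σ-isEmpty n (g ∘ (false ∷_)) ⟩
    g ∅ ∎

  Σ-isSingleton : ∀ n (g : Vec Bool n → Carrier) →
                  Σ+ (λ V → ⟦ isSingleton V ⟧ * g V) (allVecs n) ≈ Σ+ (g ∘ ⁅_⁆) (allFin n)
  Σ-isSingleton zero    g = ≈-trans (+-identityʳ _) (zeroˡ _)
  Σ-isSingleton (suc n) g = begin
    Σ+ (λ V → ⟦ isSingleton V ⟧ * g V) (allVecs (suc n))
      ≈⟨ Σ+-allVecs-suc (λ V → ⟦ isSingleton V ⟧ * g V) ⟩
    Σ+ (λ V → ⟦ isSingleton V ⟧ * g (false ∷ V) + ⟦ isEmpty V ⟧ * g (true ∷ V)) (allVecs n)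
      ≈⟨ Σ+-+ _ _ (allVecs n) ⟩
    Σ+ (λ V → ⟦ isSingleton V ⟧ * g (false ∷ V)) (allVecs n)
      + Σ+ (λ V → ⟦ isEmpty V ⟧ * g (true ∷ V)) (allVecs n)
      ≈⟨ +-cong (Σ-isSingleton n (g ∘ (false ∷_))) (Σ-isEmpty n (g ∘ (true ∷_))) ⟩
    Σ+ (λ p → g ⁅ fsuc p ⁆) (allFin n) + g ⁅ fzero ⁆
      ≈⟨ +-comm _ _ ⟩
    g ⁅ fzero ⁆ + Σ+ (λ p → g ⁅ fsuc p ⁆) (allFin n)
      ≈⟨ ≈-sym (Σ+-allFin-suc (g ∘ ⁅_⁆)) ⟩
    Σ+ (g ∘ ⁅_⁆) (allFin (suc n)) ∎

  Σ-isSubsetOf⁅0⁆ : ∀ n (h : Vec Bool (suc n) → Carrier) →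
                    Σ+ (λ V → ⟦ isSubsetOf⁅0⁆ V ⟧ * h V) (allVecs (suc n)) ≈ h ∅ + h ⁅ fzero ⁆
  Σ-isSubsetOf⁅0⁆ n h = begin
    Σ+ (λ V → ⟦ isSubsetOf⁅0⁆ V ⟧ * h V) (allVecs (suc n))
      ≈⟨ Σ+-allVecs-suc (λ V → ⟦ isSubsetOf⁅0⁆ V ⟧ * h V) ⟩
    Σ+ (λ V → ⟦ isEmpty V ⟧ * h (false ∷ V) + ⟦ isEmpty V ⟧ * h (true ∷ V)) (allVecs n)
      ≈⟨ Σ+-+ _ _ (allVecs n) ⟩
    Σ+ (λ V → ⟦ isEmpty V ⟧ * h (false ∷ V)) (allVecs n) + Σ+ (λ V → ⟦ isEmpty V ⟧ * h (true ∷ V)) (allVecs n)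
      ≈⟨ +-cong (Σ-isEmpty n (h ∘ (false ∷_))) (Σ-isEmpty n (h ∘ (true ∷_))) ⟩
    h ∅ + h ⁅ fzero ⁆ ∎

  Σ-Π-distrib : ∀ n (f : Bool → Fin n → Carrier) →
                Σ+ (λ V → Π* (λ i → f (vlookup V i) i) (allFin n)) (allVecs n)
                ≈ Π* (λ i → f true i + f false i) (allFin n)
  Σ-Π-distrib zero    f = +-identityʳ _
  Σ-Π-distrib (suc n) f = begin
    Σ+ (λ V → Π* (λ i → f (vlookup V i) i) (allFin (suc n))) (allVecs (suc n))
      ≈⟨ Σ+-allVecs-suc (λ V → Π* (λ i → f (vlookup V i) i) (allFin (suc n))) ⟩
    Σ+ (λ V → Π* (λ i → f (vlookup (false ∷ V) i) i) (allFin (suc n))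
            + Π* (λ i → f (vlookup (true ∷ V) i) i) (allFin (suc n))) (allVecs n)
      ≈⟨ Σ+-cong (λ V → +-cong (Π*-allFin-suc (λ i → f (vlookup (false ∷ V) i) i))
                                (Π*-allFin-suc (λ i → f (vlookup (true ∷ V) i) i))) (allVecs n) ⟩
    Σ+ (λ V → f false fzero * tail V + f true fzero * tail V) (allVecs n)
      ≈⟨ Σ+-cong (λ V → ≈-sym (distribʳ (tail V) _ _)) (allVecs n) ⟩
    Σ+ (λ V → (f false fzero + f true fzero) * tail V) (allVecs n)
      ≈⟨ Σ+-distribˡ _ tail (allVecs n) ⟩
    (f false fzero + f true fzero) * Σ+ tail (allVecs n)
      ≈⟨ *-cong (+-comm _ _) (Σ-Π-distrib n (λ b i → f b (fsuc i))) ⟩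
    (f true fzero + f false fzero) * Π* (λ i → f true (fsuc i) + f false (fsuc i)) (allFin n)
      ≈⟨ ≈-sym (Π*-allFin-suc (λ i → f true i + f false i)) ⟩
    Π* (λ i → f true i + f false i) (allFin (suc n)) ∎
    where
    tail : Vec Bool n → Carrier
    tail V = Π* (λ i → f (vlookup V i) (fsuc i)) (allFin n)

  ⟦not⟧ : ∀ b → ⟦ not b ⟧ ≈ (if b then 0# else 1#)
  ⟦not⟧ true  = ≈-refl
  ⟦not⟧ false = ≈-refl

  ⟦∧⟧-+-if : ∀ r g b s → ⟦ g ∧ b ⟧ * r + (if g then s else 1#) ≈ (if g then ⟦ b ⟧ * r + s else 1#)
  ⟦∧⟧-+-if r true  b s = ≈-refl
  ⟦∧⟧-+-if r false b s = ≈-trans (+-congʳ (zeroˡ r)) (+-identityˡ 1#)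

  claimed-or-passed : ∀ r a g b s → (⟦ not a ∨ (g ∧ b) ⟧ * (if a then r else 1#)) * (if g ∧ not a then s else 1#)
                                ≈ (if a then ⟦ g ∧ b ⟧ * r else (if g then s else 1#))
  claimed-or-passed r true  true  b s = *-identityʳ _
  claimed-or-passed r true  false b s = *-identityʳ _
  claimed-or-passed r false true  b s = ≈-trans (*-congʳ (*-identityˡ 1#)) (*-identityˡ s)
  claimed-or-passed r false false b s = ≈-trans (*-congʳ (*-identityˡ 1#)) (*-identityˡ 1#)

module Translation {c ℓ} (S : CommutativeSemiring c ℓ) (k : ℕ) where
  open CommutativeSemiring S hiding (zero) renaming (refl to ≈-refl; sym to ≈-sym; trans to ≈-trans)
  open Sem S using (Σ+; Π*; pow; ⟦_⟧; stepVal; WE)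
  open Eval S using (count; monoVal; sumTuple)
  open Sums S
  open import Relation.Binary.Reasoning.Setoid setoid

  stepVal-cong : ∀ {w : Word k} {Q} (ps : List (Pair k Carrier)) {σ τ : Assign w} →
                 SetVarsInˢ Q ps → Agree Q σ τ → stepVal ps w σ ≡ stepVal ps w τ
  stepVal-cong []             h          ag = refl
  stepVal-cong ((φ , r) ∷ ps) (hφ ,, hs) ag =
    cong₂ _+_ (cong (λ b → ⟦ b ⟧ * r) (bsat-cong φ hφ ag)) (stepVal-cong ps hs ag)

  WE-cong : ∀ {w : Word k} {Q} (φ : RMSOL k Carrier) {σ τ : Assign w} →
            SetVarsInʳ Q φ → Agree Q σ τ → WE φ w σ ≈ WE φ w τ
  WE-cong (const r)                h          ag = ≈-refl
  WE-cong (P a x)                  h          ag = reflexive (cong ⟦_⟧ (sat-cong (P a x) h ag))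
  WE-cong (¬P a x)                 h          ag = reflexive (cong (⟦_⟧ ∘ not) (sat-cong (P a x) h ag))
  WE-cong (x ≤' y)                 h          ag = reflexive (cong ⟦_⟧ (sat-cong (x ≤' y) h ag))
  WE-cong (x ≰' y)                 h          ag = reflexive (cong (⟦_⟧ ∘ not) (sat-cong (x ≤' y) h ag))
  WE-cong (x ∈' X)                 h          ag = reflexive (cong ⟦_⟧ (sat-cong (x ∈' X) h ag))
  WE-cong (x ∉' X)                 h          ag = reflexive (cong (⟦_⟧ ∘ not) (sat-cong (x ∈' X) h ag))
  WE-cong (φ ∨' ψ)                 (hφ ,, hψ) ag = +-cong (WE-cong φ hφ ag) (WE-cong ψ hψ ag)
  WE-cong (φ ∧' ψ)                 (hφ ,, hψ) ag = *-cong (WE-cong φ hφ ag) (WE-cong ψ hψ ag)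
  WE-cong {w = w} (∃₁ x φ)         h          ag = Σ+-cong (λ i → WE-cong φ h (Agree-update₁ x i ag)) (allPos w)
  WE-cong {w = w} (∃₂ X φ)         h          ag = Σ+-cong (λ A → WE-cong φ h (Agree-update₂ X A ag)) (allSets w)
  WE-cong {w = w} (∀₂b X ψ)        h          ag =
    Π*-cong (λ A → reflexive (cong ⟦_⟧ (bsat-cong ψ h (Agree-update₂ X A ag)))) (allSets w)
  WE-cong {w = w} (∀₁step x ps)    h          ag =
    Π*-cong (λ i → reflexive (stepVal-cong ps h (Agree-update₁ x i ag))) (allPos w)

  formulaOf : Monomial k Carrier → MSOL k
  formulaOf (mono v ψ r) = ψ

  SetVarsInᵐ : (ℕ → Set) → List (Monomial k Carrier) → Set c
  SetVarsInᵐ Q = All (SetVarsIn Q ∘ formulaOf)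

  SetVarsInᵐ-mono : ∀ {Q Q′ : ℕ → Set} → (∀ Z → Q Z → Q′ Z) →
                    ∀ {ms} → SetVarsInᵐ Q ms → SetVarsInᵐ Q′ ms
  SetVarsInᵐ-mono Q⊆Q′ = All.map (λ {m} → SetVarsIn-mono (formulaOf m) Q⊆Q′)

  monosVal : ∀ {w : Word k} → List (Monomial k Carrier) → Assign w → Carrier
  monosVal {w} ms σ = Π* (λ m → monoVal m w σ) ms

  monosVal-++ : ∀ {w : Word k} ms₁ ms₂ (σ : Assign w) →
                monosVal (ms₁ ++ ms₂) σ ≈ monosVal ms₁ σ * monosVal ms₂ σ
  monosVal-++ []        ms₂ σ = ≈-sym (*-identityˡ _)
  monosVal-++ (m ∷ ms₁) ms₂ σ = ≈-trans (*-congˡ (monosVal-++ ms₁ ms₂ σ)) (≈-sym (*-assoc _ _ _))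

  count-cong : ∀ {w : Word k} {p q : Pos w → Bool} → (∀ i → p i ≡ q i) → count w p ≡ count w q
  count-cong {w} p≗q = foldr-cong (λ i n → cong (λ b → if b then suc n else n) (p≗q i)) refl (allPos w)

  count-none : ∀ (w : Word k) → count w (λ _ → false) ≡ 0
  count-none w = foldr-skip (allPos w)

  monoVal-cong : ∀ {w : Word k} {Q} m {σ τ : Assign w} → SetVarsIn Q (formulaOf m) → Agree Q σ τ →
                 monoVal m w σ ≡ monoVal m w τ
  monoVal-cong {w} (mono v ψ r) h ag = cong (pow r) (count-cong {w = w} (λ i → sat-cong ψ h (Agree-update₁ v i ag)))

  monosVal-cong : ∀ {w : Word k} {Q} ms {σ τ : Assign w} → SetVarsInᵐ Q ms → Agree Q σ τ →
                  monosVal ms σ ≡ monosVal ms τ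
  monosVal-cong []       []       ag = refl
  monosVal-cong (m ∷ ms) (h ∷ hs) ag = cong₂ _*_ (monoVal-cong m h ag) (monosVal-cong ms hs ag)

  module _ {w : Word k} where

    DependsOn : (ℕ → Set) → (Assign w → Carrier) → Set ℓ
    DependsOn Q F = ∀ {σ τ} → Agree Q σ τ → F σ ≈ F τ

    guarded : MSOL k → List (Monomial k Carrier) → Assign w → Carrier
    guarded φ ms σ = ⟦ sat φ w σ ⟧ * monosVal ms σ

    guarded-∧-++ : ∀ φ ψ ms₁ ms₂ σ →
                   guarded (φ ∧' ψ) (ms₁ ++ ms₂) σ ≈ guarded φ ms₁ σ * guarded ψ ms₂ σ
    guarded-∧-++ φ ψ ms₁ ms₂ σ =
      ≈-trans (*-cong (⟦∧⟧ (sat φ w σ) (sat ψ w σ)) (monosVal-++ ms₁ ms₂ σ)) (*-interchange _ _ _ _)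

    guarded-dep : ∀ {Q} φ ms → SetVarsIn Q φ → SetVarsInᵐ Q ms → DependsOn Q (guarded φ ms)
    guarded-dep φ ms hφ hms ag = reflexive (cong₂ _*_ (cong ⟦_⟧ (sat-cong φ hφ ag)) (monosVal-cong ms hms ag))

    sumTuple-cong : ∀ Rs {F G : Assign w → Carrier} σ → (∀ σ′ → F σ′ ≈ G σ′) →
                    sumTuple w Rs F σ ≈ sumTuple w Rs G σ
    sumTuple-cong []       σ F≈G = F≈G σ
    sumTuple-cong (X ∷ Rs) σ F≈G = Σ+-cong (λ A → sumTuple-cong Rs (σ [ X ↦₂ A ]) F≈G) (allSets w)

    sumTuple-dep : ∀ {Q} Rs (F : Assign w → Carrier) → DependsOn Q F → DependsOn Q (sumTuple w Rs F)
    sumTuple-dep []       F F-resp ag = F-resp ag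
    sumTuple-dep (X ∷ Rs) F F-resp ag = Σ+-cong (λ A → sumTuple-dep Rs F F-resp (Agree-update₂ X A ag)) (allSets w)

    sumTuple-ext : ∀ {Q} Rs {F G : Assign w → Carrier} → Fresh Q Rs →
                   ∀ σ → (∀ σ′ → Agree Q σ′ σ → F σ′ ≈ G σ′) →
                   sumTuple w Rs F σ ≈ sumTuple w Rs G σ
    sumTuple-ext []       []          σ F≈G = F≈G σ Agree-refl
    sumTuple-ext (X ∷ Rs) (X∉Q ∷ fr) σ F≈G =
      Σ+-cong (λ A → sumTuple-ext Rs fr (σ [ X ↦₂ A ])
                       (λ σ′ ag → F≈G σ′ (Agree-trans ag (Agree-sym (Agree-fresh X A X∉Q))))) (allSets w)

    sumTuple-distribˡ : ∀ Rs (r : Carrier) (F : Assign w → Carrier) σ →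
                        sumTuple w Rs (λ σ′ → r * F σ′) σ ≈ r * sumTuple w Rs F σ
    sumTuple-distribˡ []       r F σ = ≈-refl
    sumTuple-distribˡ (X ∷ Rs) r F σ =
      ≈-trans (Σ+-cong (λ A → sumTuple-distribˡ Rs r F (σ [ X ↦₂ A ])) (allSets w))
              (Σ+-distribˡ r _ (allSets w))

    sumTuple-distribʳ : ∀ Rs (r : Carrier) (F : Assign w → Carrier) σ →
                        sumTuple w Rs (λ σ′ → F σ′ * r) σ ≈ sumTuple w Rs F σ * r
    sumTuple-distribʳ Rs r F σ =
      ≈-trans (sumTuple-cong Rs σ (λ σ′ → *-comm _ r)) (≈-trans (sumTuple-distribˡ Rs r F σ) (*-comm r _))

    sumTuple-pull : ∀ {Q} Rs (K F : Assign w → Carrier) → Fresh Q Rs → DependsOn Q K → ∀ σ →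
                    sumTuple w Rs (λ σ′ → K σ′ * F σ′) σ ≈ K σ * sumTuple w Rs F σ
    sumTuple-pull Rs K F fr K-dep σ =
      ≈-trans (sumTuple-ext Rs fr σ (λ σ′ ag → *-congʳ (K-dep ag))) (sumTuple-distribˡ Rs (K σ) F σ)

    sumTuple-++ : ∀ Rs₁ Rs₂ (F : Assign w → Carrier) σ →
                  sumTuple w (Rs₁ ++ Rs₂) F σ ≈ sumTuple w Rs₁ (sumTuple w Rs₂ F) σ
    sumTuple-++ []        Rs₂ F σ = ≈-refl
    sumTuple-++ (X ∷ Rs₁) Rs₂ F σ = Σ+-cong (λ A → sumTuple-++ Rs₁ Rs₂ F (σ [ X ↦₂ A ])) (allSets w)

    sumTuple-update₁ : ∀ Rs (F : Assign w → Carrier) x i σ →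
                       sumTuple w Rs (λ σ′ → F (σ′ [ x ↦₁ i ])) σ ≈ sumTuple w Rs F (σ [ x ↦₁ i ])
    sumTuple-update₁ []       F x i σ = ≈-refl
    sumTuple-update₁ (X ∷ Rs) F x i σ = Σ+-cong (λ A → sumTuple-update₁ Rs F x i (σ [ X ↦₂ A ])) (allSets w)

    sumTuple-select : ∀ n (sel : MSOL k) (p : PSet w → Bool) → (∀ σ → sat sel w σ ≡ p (so σ n)) →
                      ∀ Rs φ (F : Assign w → Carrier) → Fresh (_≡ n) Rs → ∀ σ A →
                      sumTuple w Rs (λ σ′ → ⟦ sat (sel ∧' φ) w σ′ ⟧ * F σ′) (σ [ n ↦₂ A ])
                      ≈ ⟦ p A ⟧ * sumTuple w Rs (λ σ′ → ⟦ sat φ w σ′ ⟧ * F σ′) (σ [ n ↦₂ A ])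
    sumTuple-select n sel p sat-sel Rs φ F fresh σ A = begin
      sumTuple w Rs (λ σ′ → ⟦ sat sel w σ′ ∧ sat φ w σ′ ⟧ * F σ′) (σ [ n ↦₂ A ])
        ≈⟨ sumTuple-cong Rs _ (λ σ′ → ≈-trans (*-congʳ (⟦∧⟧ (sat sel w σ′) _)) (*-assoc _ _ _)) ⟩
      sumTuple w Rs (λ σ′ → ⟦ sat sel w σ′ ⟧ * (⟦ sat φ w σ′ ⟧ * F σ′)) (σ [ n ↦₂ A ])
        ≈⟨ sumTuple-pull Rs _ _ fresh sel-dep (σ [ n ↦₂ A ]) ⟩
      ⟦ sat sel w (σ [ n ↦₂ A ]) ⟧ * sumTuple w Rs (λ σ′ → ⟦ sat φ w σ′ ⟧ * F σ′) (σ [ n ↦₂ A ])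
        ≈⟨ *-congʳ (reflexive (cong ⟦_⟧ (trans (sat-sel _) (cong p (update₂-same σ n A))))) ⟩
      ⟦ p A ⟧ * sumTuple w Rs (λ σ′ → ⟦ sat φ w σ′ ⟧ * F σ′) (σ [ n ↦₂ A ]) ∎
      where
      sel-dep : DependsOn (_≡ n) (λ σ′ → ⟦ sat sel w σ′ ⟧)
      sel-dep {σ₁} {σ₂} ag =
        reflexive (cong ⟦_⟧ (trans (sat-sel σ₁) (trans (cong p (so-agree ag n refl)) (sym (sat-sel σ₂)))))

    sumTuple-AllEmpty : ∀ {Q} m d (F : Assign w → Carrier) → Fresh Q (range m d) → DependsOn Q F → ∀ σ →
                        sumTuple w (range m d) (λ σ′ → ⟦ sat (AllEmpty (range m d)) w σ′ ⟧ * F σ′) σ ≈ F σ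
    sumTuple-AllEmpty m zero    F fr F-dep σ = *-identityˡ (F σ)
    sumTuple-AllEmpty m (suc d) F (m∉Q ∷ fr) F-dep σ = begin
      Σ+ (λ A → sumTuple w R (λ σ′ → ⟦ sat (Empty m ∧' AllEmpty R) w σ′ ⟧ * F σ′) (σ [ m ↦₂ A ])) (allSets w)
        ≈⟨ Σ+-cong (sumTuple-select m (Empty m) isEmpty (sat-Empty m) R (AllEmpty R) F (range-suc-fresh m d) σ)
                   (allSets w) ⟩
      Σ+ (λ A → ⟦ isEmpty A ⟧ * sumTuple w R G (σ [ m ↦₂ A ])) (allSets w)
        ≈⟨ Σ-isEmpty _ (λ A → sumTuple w R G (σ [ m ↦₂ A ])) ⟩
      sumTuple w R G (σ [ m ↦₂ ∅ ])
        ≈⟨ sumTuple-AllEmpty (suc m) d F fr F-dep (σ [ m ↦₂ ∅ ]) ⟩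
      F (σ [ m ↦₂ ∅ ])
        ≈⟨ F-dep (Agree-sym (Agree-fresh m ∅ m∉Q)) ⟩
      F σ ∎
      where
      R : List ℕ
      R = range (suc m) d
      G : Assign w → Carrier
      G σ′ = ⟦ sat (AllEmpty R) w σ′ ⟧ * F σ′

  -- Set variable n collects the positions where the disjunct (φ , r) is chosen; g holds exactly at the
  -- positions not yet claimed by an earlier disjunct.
  stepCond : ℕ → MSOL k → List (Pair k Carrier) → (ℕ → ℕ) → ℕ → MSOL k
  stepCond x g []             ρ n = ∀₁ x (¬' g)
  stepCond x g ((φ , r) ∷ ps) ρ n =
    ∀₁ x ((¬' (x ∈' n)) ∨' (g ∧' translateᵇ φ ρ n)) ∧' stepCond x (g ∧' (¬' (x ∈' n))) ps ρ (suc n)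

  stepMonos : ℕ → List (Pair k Carrier) → ℕ → List (Monomial k Carrier)
  stepMonos x []             n = []
  stepMonos x ((φ , r) ∷ ps) n = mono x (x ∈' n) r ∷ stepMonos x ps (suc n)

  SetVarsIn-stepMonos : ∀ {Q : ℕ → Set} x ps n → SetVarsInᵐ (InScope Q n (length ps)) (stepMonos x ps n)
  SetVarsIn-stepMonos x []             n = []
  SetVarsIn-stepMonos x ((φ , r) ∷ ps) n =
    InScope-base n (length ps)
    ∷ SetVarsInᵐ-mono (λ Z → InScope-suc n (length ps)) (SetVarsIn-stepMonos x ps (suc n))

  SetVarsIn-stepCond : ∀ (G Q : ℕ → Set) x g (ps : List (Pair k Carrier)) ρ n → (∀ Z → Q Z → G Z) →
                       SetVarsIn G g → SetVarsInˢ (Q ∘ ρ) ps →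
                       SetVarsIn (InScope G n (length ps)) (stepCond x g ps ρ n)
  SetVarsIn-stepCond G Q x g []             ρ n Q⊆G hg hps        = SetVarsIn-mono g (λ _ → free) hg
  SetVarsIn-stepCond G Q x g ((φ , r) ∷ ps) ρ n Q⊆G hg (hφ ,, hps) =
    (InScope-base n len ,, (SetVarsIn-mono g (λ _ → free) hg
                         ,, SetVarsIn-mono (translateᵇ φ ρ n) (λ Z → free ∘ Q⊆G Z) (SetVarsIn-translateᵇ Q ρ n φ hφ)))
    ,, SetVarsIn-mono (stepCond x (g ∧' (¬' (x ∈' n))) ps ρ (suc n)) widen
         (SetVarsIn-stepCond (n ◃ G) Q x _ ps ρ (suc n) (λ Z → inj₂ ∘ Q⊆G Z)
                             (SetVarsIn-mono g (λ _ → inj₂) hg ,, inj₁ refl) hps)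
    where
    len : ℕ
    len = length ps
    widen : ∀ Z → InScope (n ◃ G) (suc n) len Z → InScope G n (suc len) Z
    widen Z (free (inj₁ refl)) = InScope-base n len
    widen Z (free (inj₂ g))    = free g
    widen Z (window n<Z Z<)    = InScope-suc n len (window n<Z Z<)

  module StepCase {w : Word k} (G Q : ℕ → Set) (x : ℕ) (g : MSOL k) (φ : bMSOL k) (r : Carrier)
                  (ps : List (Pair k Carrier)) (ρ : ℕ → ℕ) (n : ℕ) (G<n : Below G n) (Q⊆G : ∀ Z → Q Z → G Z)
                  (hg : SetVarsIn G g) (hφ : SetVarsInᵇ (Q ∘ ρ) φ) (hps : SetVarsInˢ (Q ∘ ρ) ps)
                  (σ : Assign w) where

    claim : MSOL k
    claim = ∀₁ x ((¬' (x ∈' n)) ∨' (g ∧' translateᵇ φ ρ n))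

    K : Assign w → Carrier
    K = guarded claim (mono x (x ∈' n) r ∷ [])

    gᵢ φᵢ : Pos w → Bool
    gᵢ i = sat g w (σ [ x ↦₁ i ])
    φᵢ i = bsat φ w (renameSets σ ρ [ x ↦₁ i ])

    restᵢ : Pos w → Carrier
    restᵢ i = stepVal ps w (renameSets σ ρ [ x ↦₁ i ])

    -- The factor of position i according to whether (φ , r) claims it (b = true) or passes it on.
    f : Bool → Pos w → Carrier
    f b i = if b then ⟦ gᵢ i ∧ φᵢ i ⟧ * r else (if gᵢ i then restᵢ i else 1#)

    K-dep : DependsOn (n ◃ G) K
    K-dep = guarded-dep claim (mono x (x ∈' n) r ∷ [])
              (inj₁ refl ,, (SetVarsIn-mono g (λ _ → inj₂) hg
                            ,, SetVarsIn-mono (translateᵇ φ ρ n) (λ Z → inj₂ ∘ Q⊆G Z) (SetVarsIn-translateᵇ Q ρ n φ hφ)))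
              (inj₁ refl ∷ [])

    private
      unchanged : ∀ A i → Agree G (σ [ n ↦₂ A ] [ x ↦₁ i ]) (σ [ x ↦₁ i ])
      unchanged A i = Agree-sym (Agree-fresh {σ = σ [ x ↦₁ i ]} n A (λ g-n → <-irrefl refl (G<n n g-n)))

      renamed : ∀ A i → Agree (Q ∘ ρ) (renameSets (σ [ n ↦₂ A ] [ x ↦₁ i ]) ρ) (renameSets σ ρ [ x ↦₁ i ])
      renamed A i = renameSets-cong ρ (λ Z q → Q⊆G (ρ Z) q) (unchanged A i)

      x∈n : ∀ A i → sat (x ∈' n) w (σ [ n ↦₂ A ] [ x ↦₁ i ]) ≡ vlookup A i
      x∈n A i = cong₂ (λ j V → vlookup V j) (update₁-same (σ [ n ↦₂ A ]) x i) (update₂-same σ n A)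

      g-val : ∀ A i → sat g w (σ [ n ↦₂ A ] [ x ↦₁ i ]) ≡ gᵢ i
      g-val A i = sat-cong g hg (unchanged A i)

      φ-val : ∀ A i → sat (translateᵇ φ ρ n) w (σ [ n ↦₂ A ] [ x ↦₁ i ]) ≡ φᵢ i
      φ-val A i = trans (sat-translateᵇ Q ρ n (λ Z q → G<n Z (Q⊆G Z q)) φ hφ (σ [ n ↦₂ A ] [ x ↦₁ i ]))
                        (bsat-cong φ hφ (renamed A i))

    K-val : ∀ A → K (σ [ n ↦₂ A ]) ≈ Π* (λ i → ⟦ not (vlookup A i) ∨ (gᵢ i ∧ φᵢ i) ⟧) (allPos w)
                                   * Π* (λ i → if vlookup A i then r else 1#) (allPos w)
    K-val A = *-cong
      (≈-trans (reflexive (cong ⟦_⟧ (allB-cong (λ i → cong₂ _∨_ (cong not (x∈n A i))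
                                                                (cong₂ _∧_ (g-val A i) (φ-val A i)))
                                               (allPos w))))
               (⟦allB⟧ (λ i → not (vlookup A i) ∨ (gᵢ i ∧ φᵢ i)) (allPos w)))
      (≈-trans (*-identityʳ _) (≈-trans (reflexive (cong (pow r) (count-cong {w = w} (x∈n A))))
                                        (pow-count r (vlookup A) (allPos w))))

    unclaimedVal : PSet w → Carrier
    unclaimedVal A = Π* (λ i → if sat (g ∧' (¬' (x ∈' n))) w (σ [ n ↦₂ A ] [ x ↦₁ i ])
                               then stepVal ps w (renameSets (σ [ n ↦₂ A ]) ρ [ x ↦₁ i ]) else 1#) (allPos w)

    rest-val : ∀ A → unclaimedVal A ≈ Π* (λ i → if gᵢ i ∧ not (vlookup A i) then restᵢ i else 1#) (allPos w)
    rest-val A = Π*-cong (λ i → reflexive (cong₂ (λ b s → if b then s else 1#)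
                                                 (cong₂ _∧_ (g-val A i) (cong not (x∈n A i)))
                                                 (stepVal-cong ps hps (renamed A i)))) (allPos w)

    combine : ∀ A → Π* (λ i → ⟦ not (vlookup A i) ∨ (gᵢ i ∧ φᵢ i) ⟧) (allPos w)
                    * Π* (λ i → if vlookup A i then r else 1#) (allPos w)
                    * Π* (λ i → if gᵢ i ∧ not (vlookup A i) then restᵢ i else 1#) (allPos w)
                    ≈ Π* (λ i → f (vlookup A i) i) (allPos w)
    combine A = ≈-trans (*-congʳ (≈-sym (Π*-* _ _ (allPos w))))
                (≈-trans (≈-sym (Π*-* _ _ (allPos w)))
                         (Π*-cong (λ i → claimed-or-passed r (vlookup A i) (gᵢ i) (φᵢ i) (restᵢ i)) (allPos w)))

  sum-stepCond : ∀ {w : Word k} (G Q : ℕ → Set) x g (ps : List (Pair k Carrier)) ρ n →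
                 Below G n → (∀ Z → Q Z → G Z) → SetVarsIn G g → SetVarsInˢ (Q ∘ ρ) ps → ∀ (σ : Assign w) →
                 sumTuple w (range n (length ps)) (guarded (stepCond x g ps ρ n) (stepMonos x ps n)) σ
                 ≈ Π* (λ i → if sat g w (σ [ x ↦₁ i ]) then stepVal ps w (renameSets σ ρ [ x ↦₁ i ]) else 1#)
                      (allPos w)
  sum-stepCond {w} G Q x g [] ρ n G<n Q⊆G hg hps σ = begin
    ⟦ allB (not ∘ gᵢ) (allPos w) ⟧ * 1#       ≈⟨ *-identityʳ _ ⟩
    ⟦ allB (not ∘ gᵢ) (allPos w) ⟧            ≈⟨ ⟦allB⟧ (not ∘ gᵢ) (allPos w) ⟩
    Π* (⟦_⟧ ∘ not ∘ gᵢ) (allPos w)             ≈⟨ Π*-cong (⟦not⟧ ∘ gᵢ) (allPos w) ⟩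
    Π* (λ i → if gᵢ i then 0# else 1#) (allPos w) ∎
    where
    gᵢ : Pos w → Bool
    gᵢ i = sat g w (σ [ x ↦₁ i ])
  sum-stepCond {w} G Q x g ((φ , r) ∷ ps) ρ n G<n Q⊆G hg (hφ ,, hps) σ = begin
    Σ+ (λ A → sumTuple w R (guarded (claim ∧' rest) (mono x (x ∈' n) r ∷ ms)) (σ [ n ↦₂ A ])) (allSets w)
      ≈⟨ Σ+-cong (λ A → ≈-trans (sumTuple-cong R _ (guarded-∧-++ claim rest (mono x (x ∈' n) r ∷ []) ms))
                                 (sumTuple-pull R K _ R-fresh K-dep (σ [ n ↦₂ A ]))) (allSets w) ⟩
    Σ+ (λ A → K (σ [ n ↦₂ A ]) * sumTuple w R (guarded rest ms) (σ [ n ↦₂ A ])) (allSets w)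
      ≈⟨ Σ+-cong (λ A → ≈-trans (*-cong (K-val A) (≈-trans (recurse A) (rest-val A))) (combine A))
                 (allSets w) ⟩
    Σ+ (λ A → Π* (λ i → f (vlookup A i) i) (allPos w)) (allSets w)
      ≈⟨ Σ-Π-distrib _ f ⟩
    Π* (λ i → f true i + f false i) (allPos w)
      ≈⟨ Π*-cong (λ i → ⟦∧⟧-+-if r (gᵢ i) (φᵢ i) (restᵢ i)) (allPos w) ⟩
    Π* (λ i → if gᵢ i then stepVal ((φ , r) ∷ ps) w (renameSets σ ρ [ x ↦₁ i ]) else 1#) (allPos w) ∎
    where
    open StepCase G Q x g φ r ps ρ n G<n Q⊆G hg hφ hps σ
    rest : MSOL k
    rest = stepCond x (g ∧' (¬' (x ∈' n))) ps ρ (suc n)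
    ms : List (Monomial k Carrier)
    ms = stepMonos x ps (suc n)
    R : List ℕ
    R = range (suc n) (length ps)
    R-fresh : Fresh (n ◃ G) R
    R-fresh = Below-fresh-range (suc n) (length ps) (Below-◃ {Q = G} n G<n)
    recurse : ∀ A → sumTuple w R (guarded rest ms) (σ [ n ↦₂ A ]) ≈ unclaimedVal A
    recurse A = sum-stepCond (n ◃ G) Q x _ ps ρ (suc n) (Below-◃ {Q = G} n G<n) (λ Z → inj₂ ∘ Q⊆G Z)
                             (SetVarsIn-mono g (λ _ → inj₂) hg ,, inj₁ refl) hps (σ [ n ↦₂ A ])

  record NF : Set c where
    constructor nf
    field
      size  : ℕ
      cond  : MSOL k
      monos : List (Monomial k Carrier)
  open NF

  NFVarsIn : (ℕ → Set) → NF → Set c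
  NFVarsIn Q A = SetVarsIn Q (cond A) × SetVarsInᵐ Q (monos A)

  NFVarsIn-mono : ∀ {Q Q′ : ℕ → Set} A → (∀ Z → Q Z → Q′ Z) → NFVarsIn Q A → NFVarsIn Q′ A
  NFVarsIn-mono A Q⊆Q′ (hc ,, hms) = SetVarsIn-mono (cond A) Q⊆Q′ hc ,, SetVarsInᵐ-mono Q⊆Q′ hms

  evalNF : ∀ {w : Word k} → NF → ℕ → Assign w → Carrier
  evalNF {w} A n = sumTuple w (range n (size A)) (guarded (cond A) (monos A))

  NFVarsIn-guarded-dep : ∀ {w : Word k} {Q} A → NFVarsIn Q A → DependsOn {w = w} Q (guarded (cond A) (monos A))
  NFVarsIn-guarded-dep A (hc ,, hms) = guarded-dep (cond A) (monos A) hc hms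

  evalNF-dep : ∀ {w : Word k} {Q} A n → NFVarsIn Q A → DependsOn {w = w} Q (evalNF A n)
  evalNF-dep A n vars = sumTuple-dep (range n (size A)) _ (NFVarsIn-guarded-dep A vars)

  _⊗_ : NF → NF → NF
  A ⊗ B = nf (size A +ℕ size B) (cond A ∧' cond B) (monos A ++ monos B)

  evalNF-⊗ : ∀ {w : Word k} {Q} A B n → Below Q n → NFVarsIn (InScope Q n (size A)) A →
             NFVarsIn (InScope Q (n +ℕ size A) (size B)) B → ∀ (σ : Assign w) →
             evalNF (A ⊗ B) n σ ≈ evalNF A n σ * evalNF B (n +ℕ size A) σ
  evalNF-⊗ {w} {Q} A B n Q<n varsA varsB σ = begin
    sumTuple w (range n (size A +ℕ size B)) (guarded (cond A ∧' cond B) (monos A ++ monos B)) σ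
      ≡⟨ cong (λ Rs → sumTuple w Rs _ σ) (range-++ n (size A) (size B)) ⟩
    sumTuple w (RA ++ RB) (guarded (cond A ∧' cond B) (monos A ++ monos B)) σ
      ≈⟨ sumTuple-++ RA RB _ σ ⟩
    sumTuple w RA (sumTuple w RB (guarded (cond A ∧' cond B) (monos A ++ monos B))) σ
      ≈⟨ sumTuple-cong RA σ (λ σ₁ → sumTuple-cong RB σ₁ (guarded-∧-++ (cond A) (cond B) (monos A) (monos B))) ⟩
    sumTuple w RA (sumTuple w RB (λ σ′ → gA σ′ * gB σ′)) σ
      ≈⟨ sumTuple-cong RA σ (sumTuple-pull RB gA gB RB-fresh (NFVarsIn-guarded-dep A varsA)) ⟩
    sumTuple w RA (λ σ₁ → gA σ₁ * evalNF B (n +ℕ size A) σ₁) σ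
      ≈⟨ sumTuple-ext RA RA-fresh σ (λ σ₁ ag → *-congˡ (evalNF-dep B (n +ℕ size A) varsB ag)) ⟩
    sumTuple w RA (λ σ₁ → gA σ₁ * evalNF B (n +ℕ size A) σ) σ
      ≈⟨ sumTuple-distribʳ RA _ gA σ ⟩
    evalNF A n σ * evalNF B (n +ℕ size A) σ ∎
    where
    RA : List ℕ
    RA = range n (size A)
    RB : List ℕ
    RB = range (n +ℕ size A) (size B)
    gA gB : Assign w → Carrier
    gA = guarded (cond A) (monos A)
    gB = guarded (cond B) (monos B)
    RB-fresh : Fresh (InScope Q n (size A)) RB
    RB-fresh = Below-fresh-range (n +ℕ size A) (size B) (InScope-below (size A) Q<n ≤-refl)
    RA-fresh : Fresh (InScope Q (n +ℕ size A) (size B)) RA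
    RA-fresh = InScope-fresh (size A) (size B) Q<n ≤-refl

  -- A monomial that itself binds x is untouched by substituting the element of Y for x.
  bindMono : ℕ → ℕ → Monomial k Carrier → Monomial k Carrier
  bindMono Y x (mono v ψ r) with v ≟ℕ x
  ... | yes _ = mono v ψ r
  ... | no  _ = mono v (∃₁ x ((x ∈' Y) ∧' ψ)) r

  monoVal-bindMono : ∀ {w : Word k} (σ : Assign w) Y x p m → so σ Y ≡ ⁅ p ⁆ →
                     monoVal (bindMono Y x m) w σ ≡ monoVal m w (σ [ x ↦₁ p ])
  monoVal-bindMono {w} σ Y x p (mono v ψ r) σY≡⁅p⁆ with v ≟ℕ x
  ... | yes refl = cong (pow r) (count-cong {w = w} (λ i →
                     sat-ext ψ (λ y → sym (update₁-shadow σ v p i y)) (λ _ → refl)))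
  ... | no  v≢x  = cong (pow r) (count-cong {w = w} (λ i →
                     trans (sat-∃∈⁅⁆ (σ [ v ↦₁ i ]) x Y p ψ σY≡⁅p⁆)
                           (sat-ext ψ (update₁-comm σ v x i p v≢x) (λ _ → refl))))

  monosVal-bindMono : ∀ {w : Word k} (σ : Assign w) Y x p ms → so σ Y ≡ ⁅ p ⁆ →
                      monosVal (map (bindMono Y x) ms) σ ≡ monosVal ms (σ [ x ↦₁ p ])
  monosVal-bindMono σ Y x p []       e = refl
  monosVal-bindMono σ Y x p (m ∷ ms) e = cong₂ _*_ (monoVal-bindMono σ Y x p m e) (monosVal-bindMono σ Y x p ms e)

  exNF : ℕ → ℕ → NF → NF
  exNF n x A = nf (suc (size A)) (Singleton n ∧' ∃₁ x ((x ∈' n) ∧' cond A)) (map (bindMono n x) (monos A))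

  evalNF-exNF : ∀ {w : Word k} {Q} A n x → Below Q n → NFVarsIn (InScope Q (suc n) (size A)) A →
                ∀ (σ : Assign w) →
                evalNF (exNF n x A) n σ ≈ Σ+ (λ p → evalNF A (suc n) (σ [ x ↦₁ p ])) (allPos w)
  evalNF-exNF {w} {Q} A n x Q<n varsA σ = begin
    Σ+ (λ V → sumTuple w RA (guarded (Singleton n ∧' ∃A) ms′) (σ [ n ↦₂ V ])) (allSets w)
      ≈⟨ Σ+-cong (sumTuple-select n (Singleton n) isSingleton (sat-Singleton n) RA ∃A (monosVal ms′)
                                  (range-suc-fresh n (size A)) σ)
                 (allSets w) ⟩
    Σ+ (λ V → ⟦ isSingleton V ⟧ * H V) (allSets w)
      ≈⟨ Σ-isSingleton _ H ⟩
    Σ+ (H ∘ ⁅_⁆) (allPos w)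
      ≈⟨ Σ+-cong at-singleton (allPos w) ⟩
    Σ+ (λ p → evalNF A (suc n) (σ [ x ↦₁ p ])) (allPos w) ∎
    where
    RA : List ℕ
    RA = range (suc n) (size A)
    ∃A : MSOL k
    ∃A = ∃₁ x ((x ∈' n) ∧' cond A)
    ms′ : List (Monomial k Carrier)
    ms′ = map (bindMono n x) (monos A)
    H : PSet w → Carrier
    H V = sumTuple w RA (guarded ∃A ms′) (σ [ n ↦₂ V ])
    bound : ∀ p σ′ → Agree (_≡ n) σ′ (σ [ n ↦₂ ⁅ p ⁆ ]) →
            guarded ∃A ms′ σ′ ≈ guarded (cond A) (monos A) (σ′ [ x ↦₁ p ])
    bound p σ′ ag = reflexive (cong₂ _*_ (cong ⟦_⟧ (sat-∃∈⁅⁆ σ′ x n p (cond A) σ′n≡⁅p⁆))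
                                         (monosVal-bindMono σ′ n x p (monos A) σ′n≡⁅p⁆))
      where
      σ′n≡⁅p⁆ : so σ′ n ≡ ⁅ p ⁆
      σ′n≡⁅p⁆ = trans (so-agree ag n refl) (update₂-same σ n ⁅ p ⁆)
    at-singleton : ∀ p → H ⁅ p ⁆ ≈ evalNF A (suc n) (σ [ x ↦₁ p ])
    at-singleton p = begin
      H ⁅ p ⁆
        ≈⟨ sumTuple-ext RA (range-suc-fresh n (size A)) (σ [ n ↦₂ ⁅ p ⁆ ]) (bound p) ⟩
      sumTuple w RA (λ σ′ → guarded (cond A) (monos A) (σ′ [ x ↦₁ p ])) (σ [ n ↦₂ ⁅ p ⁆ ])
        ≈⟨ sumTuple-update₁ RA (guarded (cond A) (monos A)) x p (σ [ n ↦₂ ⁅ p ⁆ ]) ⟩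
      evalNF A (suc n) (σ [ x ↦₁ p ] [ n ↦₂ ⁅ p ⁆ ])
        ≈⟨ evalNF-dep A (suc n) varsA (Agree-sym (Agree-fresh n ⁅ p ⁆ (∉-InScope-suc (size A) Q<n))) ⟩
      evalNF A (suc n) (σ [ x ↦₁ p ]) ∎

  guardMono : MSOL k → Monomial k Carrier → Monomial k Carrier
  guardMono G (mono v ψ r) = mono v (ψ ∧' G) r

  module _ {w : Word k} (G : MSOL k) (σ : Assign w) where

    monosVal-guard-true : (∀ v i → sat G w (σ [ v ↦₁ i ]) ≡ true) → ∀ ms →
                          monosVal (map (guardMono G) ms) σ ≡ monosVal ms σ
    monosVal-guard-true G-true []                = refl
    monosVal-guard-true G-true (mono v ψ r ∷ ms) =
      cong₂ _*_ (cong (pow r) (count-cong {w = w} (λ i →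
                  trans (cong (sat ψ w (σ [ v ↦₁ i ]) ∧_) (G-true v i)) (∧-identityʳ _))))
                (monosVal-guard-true G-true ms)

    monosVal-guard-false : (∀ v i → sat G w (σ [ v ↦₁ i ]) ≡ false) → ∀ ms →
                           monosVal (map (guardMono G) ms) σ ≈ 1#
    monosVal-guard-false G-false []                = ≈-refl
    monosVal-guard-false G-false (mono v ψ r ∷ ms) =
      ≈-trans (*-cong (reflexive (cong (pow r) (trans (count-cong {w = w} (λ i →
                                                        trans (cong (sat ψ w (σ [ v ↦₁ i ]) ∧_) (G-false v i)) (∧-zeroʳ _)))
                                                      (count-none w))))
                      (monosVal-guard-false G-false ms))
              (*-identityˡ 1#)

  -- The selector n is ∅ for the left disjunct and {0} for the right one; the set variables of the
  -- unselected disjunct are forced to be empty.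
  orChoice : ℕ → NF → NF → MSOL k
  orChoice n A B = ((¬' Empty n) ∨' (cond A ∧' AllEmpty (range (suc n +ℕ size A) (size B))))
                ∧' (Empty n ∨' (cond B ∧' AllEmpty (range (suc n) (size A))))

  orNF : ℕ → NF → NF → NF
  orNF n A B = nf (suc (size A +ℕ size B)) (SubsetOf⁅0⁆ n ∧' orChoice n A B)
                  (map (guardMono (Empty n)) (monos A) ++ map (guardMono (¬' Empty n)) (monos B))

  module _ {w : Word k} {Q : ℕ → Set} (A B : NF) (n : ℕ) (Q<n : Below Q n)
           (varsA : NFVarsIn (InScope Q (suc n) (size A)) A)
           (varsB : NFVarsIn (InScope Q (suc n +ℕ size A) (size B)) B) where

    private
      RA RB R : List ℕ
      RA = range (suc n) (size A)
      RB = range (suc n +ℕ size A) (size B)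
      R  = range (suc n) (size A +ℕ size B)
      choice : MSOL k
      choice = orChoice n A B
      msA msB : List (Monomial k Carrier)
      msA = map (guardMono (Empty n)) (monos A)
      msB = map (guardMono (¬' Empty n)) (monos B)
      gA gB zA zB : Assign w → Carrier
      gA = guarded (cond A) (monos A)
      gB = guarded (cond B) (monos B)
      zA σ′ = ⟦ sat (AllEmpty RA) w σ′ ⟧
      zB σ′ = ⟦ sat (AllEmpty RB) w σ′ ⟧
      H : Assign w → PSet w → Carrier
      H σ V = sumTuple w R (guarded choice (msA ++ msB)) (σ [ n ↦₂ V ])

      RB-fresh : Fresh (InScope Q (suc n) (size A)) RB
      RB-fresh = Below-fresh-range (suc n +ℕ size A) (size B) (InScope-below (size A) Q<n (n≤1+n n))

      RA-fresh : Fresh (InScope Q (suc n +ℕ size A) (size B)) RA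
      RA-fresh = InScope-fresh (size A) (size B) (λ Z q → m<n⇒m<1+n (Q<n Z q)) ≤-refl

      split-R : ∀ F σ → sumTuple w R F σ ≈ sumTuple w RA (sumTuple w RB F) σ
      split-R F σ = ≈-trans (reflexive (cong (λ Rs → sumTuple w Rs F σ) (range-++ (suc n) (size A) (size B))))
                            (sumTuple-++ RA RB F σ)

      Empty-n : ∀ {σ σ′ : Assign w} V → Agree (_≡ n) σ′ (σ [ n ↦₂ V ]) →
                ∀ v i → sat (Empty n) w (σ′ [ v ↦₁ i ]) ≡ isEmpty V
      Empty-n {σ} {σ′} V ag v i =
        trans (sat-Empty n (σ′ [ v ↦₁ i ])) (cong isEmpty (trans (so-agree ag n refl) (update₂-same σ n V)))

      choose-left : ∀ e a b → e ≡ true → ((not e ∨ a) ∧ (e ∨ b)) ≡ a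
      choose-left true a b refl = ∧-identityʳ a

      choose-right : ∀ e a b → e ≡ false → ((not e ∨ a) ∧ (e ∨ b)) ≡ b
      choose-right false a b refl = refl

      left-body : ∀ σ σ′ → Agree (_≡ n) σ′ (σ [ n ↦₂ ∅ ]) → guarded choice (msA ++ msB) σ′ ≈ gA σ′ * zB σ′
      left-body σ σ′ ag = begin
        ⟦ sat choice w σ′ ⟧ * monosVal (msA ++ msB) σ′
          ≈⟨ *-cong (reflexive (cong ⟦_⟧ (choose-left (sat (Empty n) w σ′) _ _ (E 0 fzero))))
                    (monosVal-++ msA msB σ′) ⟩
        ⟦ sat (cond A) w σ′ ∧ sat (AllEmpty RB) w σ′ ⟧ * (monosVal msA σ′ * monosVal msB σ′)
          ≈⟨ *-cong (⟦∧⟧ (sat (cond A) w σ′) _)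
                    (*-cong (reflexive (monosVal-guard-true (Empty n) σ′ E (monos A)))
                            (monosVal-guard-false (¬' Empty n) σ′ (λ v i → cong not (E v i)) (monos B))) ⟩
        (⟦ sat (cond A) w σ′ ⟧ * zB σ′) * (monosVal (monos A) σ′ * 1#)
          ≈⟨ ≈-trans (*-interchange _ _ _ _) (*-congˡ (*-identityʳ _)) ⟩
        gA σ′ * zB σ′ ∎
        where
        E : ∀ v i → sat (Empty n) w (σ′ [ v ↦₁ i ]) ≡ true
        E v i = trans (Empty-n ∅ ag v i) (isEmpty-∅ (suc (length w)))

      right-body : ∀ σ σ′ → Agree (_≡ n) σ′ (σ [ n ↦₂ ⁅ fzero ⁆ ]) →
                   guarded choice (msA ++ msB) σ′ ≈ zA σ′ * gB σ′
      right-body σ σ′ ag = begin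
        ⟦ sat choice w σ′ ⟧ * monosVal (msA ++ msB) σ′
          ≈⟨ *-cong (reflexive (cong ⟦_⟧ (choose-right (sat (Empty n) w σ′) _ _ (E 0 fzero))))
                    (monosVal-++ msA msB σ′) ⟩
        ⟦ sat (cond B) w σ′ ∧ sat (AllEmpty RA) w σ′ ⟧ * (monosVal msA σ′ * monosVal msB σ′)
          ≈⟨ *-cong (⟦∧⟧ (sat (cond B) w σ′) _) (*-cong (monosVal-guard-false (Empty n) σ′ E (monos A))
                    (reflexive (monosVal-guard-true (¬' Empty n) σ′ (λ v i → cong not (E v i)) (monos B)))) ⟩
        (⟦ sat (cond B) w σ′ ⟧ * zA σ′) * (1# * monosVal (monos B) σ′)
          ≈⟨ ≈-trans (*-congʳ (*-comm _ _)) (≈-trans (*-congˡ (*-identityˡ _)) (*-assoc _ _ _)) ⟩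
        zA σ′ * gB σ′ ∎
        where
        E : ∀ v i → sat (Empty n) w (σ′ [ v ↦₁ i ]) ≡ false
        E v i = Empty-n ⁅ fzero ⁆ ag v i

      left : ∀ σ → H σ ∅ ≈ evalNF A (suc n) σ
      left σ = begin
        H σ ∅
          ≈⟨ sumTuple-ext R (range-suc-fresh n _) (σ [ n ↦₂ ∅ ]) (left-body σ) ⟩
        sumTuple w R (λ σ′ → gA σ′ * zB σ′) (σ [ n ↦₂ ∅ ])
          ≈⟨ split-R _ (σ [ n ↦₂ ∅ ]) ⟩
        sumTuple w RA (sumTuple w RB (λ σ′ → gA σ′ * zB σ′)) (σ [ n ↦₂ ∅ ])
          ≈⟨ sumTuple-cong RA (σ [ n ↦₂ ∅ ]) (λ σ₁ →
               ≈-trans (sumTuple-cong RB σ₁ (λ σ′ → *-comm (gA σ′) (zB σ′)))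
                       (sumTuple-AllEmpty (suc n +ℕ size A) (size B) gA RB-fresh (NFVarsIn-guarded-dep A varsA) σ₁)) ⟩
        evalNF A (suc n) (σ [ n ↦₂ ∅ ])
          ≈⟨ evalNF-dep A (suc n) varsA (Agree-sym (Agree-fresh n ∅ (∉-InScope-suc (size A) Q<n))) ⟩
        evalNF A (suc n) σ ∎

      right : ∀ σ → H σ ⁅ fzero ⁆ ≈ evalNF B (suc n +ℕ size A) σ
      right σ = begin
        H σ ⁅ fzero ⁆
          ≈⟨ sumTuple-ext R (range-suc-fresh n _) (σ [ n ↦₂ ⁅ fzero ⁆ ]) (right-body σ) ⟩
        sumTuple w R (λ σ′ → zA σ′ * gB σ′) (σ [ n ↦₂ ⁅ fzero ⁆ ])
          ≈⟨ split-R _ (σ [ n ↦₂ ⁅ fzero ⁆ ]) ⟩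
        sumTuple w RA (sumTuple w RB (λ σ′ → zA σ′ * gB σ′)) (σ [ n ↦₂ ⁅ fzero ⁆ ])
          ≈⟨ sumTuple-cong RA (σ [ n ↦₂ ⁅ fzero ⁆ ]) (sumTuple-pull RB zA gB RB-fresh zA-dep) ⟩
        sumTuple w RA (λ σ₁ → zA σ₁ * evalNF B (suc n +ℕ size A) σ₁) (σ [ n ↦₂ ⁅ fzero ⁆ ])
          ≈⟨ sumTuple-AllEmpty (suc n) (size A) _ RA-fresh (evalNF-dep B (suc n +ℕ size A) varsB)
                               (σ [ n ↦₂ ⁅ fzero ⁆ ]) ⟩
        evalNF B (suc n +ℕ size A) (σ [ n ↦₂ ⁅ fzero ⁆ ])
          ≈⟨ evalNF-dep B (suc n +ℕ size A) varsB (Agree-sym (Agree-fresh n ⁅ fzero ⁆ n∉B)) ⟩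
        evalNF B (suc n +ℕ size A) σ ∎
        where
        zA-dep : DependsOn (InScope Q (suc n) (size A)) zA
        zA-dep ag = reflexive (cong ⟦_⟧ (sat-cong (AllEmpty RA) (SetVarsIn-AllEmpty (suc n) (size A)) ag))
        n∉B : ¬ InScope Q (suc n +ℕ size A) (size B) n
        n∉B (free q)       = <-irrefl refl (Q<n n q)
        n∉B (window le _)  = <-irrefl refl (≤-trans (m≤m+n (suc n) (size A)) le)

    evalNF-orNF : ∀ σ → evalNF (orNF n A B) n σ ≈ evalNF A (suc n) σ + evalNF B (suc n +ℕ size A) σ
    evalNF-orNF σ = begin
      Σ+ (λ V → sumTuple w R (guarded (SubsetOf⁅0⁆ n ∧' choice) (msA ++ msB)) (σ [ n ↦₂ V ])) (allSets w)
        ≈⟨ Σ+-cong (sumTuple-select n (SubsetOf⁅0⁆ n) isSubsetOf⁅0⁆ (sat-SubsetOf⁅0⁆ n) R choice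
                                    (monosVal (msA ++ msB))
                                    (range-suc-fresh n _) σ) (allSets w) ⟩
      Σ+ (λ V → ⟦ isSubsetOf⁅0⁆ V ⟧ * H σ V) (allSets w)
        ≈⟨ Σ-isSubsetOf⁅0⁆ _ (H σ) ⟩
      H σ ∅ + H σ ⁅ fzero ⁆
        ≈⟨ +-cong (left σ) (right σ) ⟩
      evalNF A (suc n) σ + evalNF B (suc n +ℕ size A) σ ∎

  -- ρ renames the set variables of φ, and n, n + 1, … are fresh.
  translate : RMSOL k Carrier → (ℕ → ℕ) → ℕ → NF
  translate (const r)     ρ n = nf 0 ⊤' (mono 0 (∀₁ 1 (0 ≤' 1)) r ∷ [])   -- r multiplied over the single least position
  translate (P a x)       ρ n = nf 0 (P a x) []
  translate (¬P a x)      ρ n = nf 0 (¬' P a x) []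
  translate (x ≤' y)      ρ n = nf 0 (x ≤' y) []
  translate (x ≰' y)      ρ n = nf 0 (¬' (x ≤' y)) []
  translate (x ∈' X)      ρ n = nf 0 (x ∈' ρ X) []
  translate (x ∉' X)      ρ n = nf 0 (¬' (x ∈' ρ X)) []
  translate (φ ∧' ψ)      ρ n = A ⊗ translate ψ ρ (n +ℕ size A)
    where
      A : NF
      A = translate φ ρ n
  translate (φ ∨' ψ)      ρ n = orNF n A (translate ψ ρ (suc n +ℕ size A))
    where
      A : NF
      A = translate φ ρ (suc n)
  translate (∃₁ x φ)      ρ n = exNF n x (translate φ ρ (suc n))
  translate (∃₂ X φ)      ρ n = nf (suc (size A)) (cond A) (monos A)
    where
      A : NF
      A = translate φ (ρ [ X ≔ n ]) (suc n)
  translate (∀₂b X ψ)     ρ n = nf 0 (translateᵇ (∀₂ X ψ) ρ n) []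
  translate (∀₁step x ps) ρ n = nf (length ps) (stepCond x ⊤' ps ρ n) (stepMonos x ps n)

  SetVarsIn-guardMonos : ∀ {Q : ℕ → Set} G ms → SetVarsIn Q G → SetVarsInᵐ Q ms →
                         SetVarsInᵐ Q (map (guardMono G) ms)
  SetVarsIn-guardMonos G []                hG []         = []
  SetVarsIn-guardMonos G (mono v ψ r ∷ ms) hG (hψ ∷ hms) = (hψ ,, hG) ∷ SetVarsIn-guardMonos G ms hG hms

  SetVarsIn-bindMonos : ∀ {Q : ℕ → Set} Y x ms → Q Y → SetVarsInᵐ Q ms → SetVarsInᵐ Q (map (bindMono Y x) ms)
  SetVarsIn-bindMonos Y x []                hY []         = []
  SetVarsIn-bindMonos Y x (mono v ψ r ∷ ms) hY (hψ ∷ hms) with v ≟ℕ x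
  ... | yes _ = hψ ∷ SetVarsIn-bindMonos Y x ms hY hms
  ... | no  _ = (hY ,, hψ) ∷ SetVarsIn-bindMonos Y x ms hY hms

  NFVarsIn-translate : ∀ (Q : ℕ → Set) φ ρ n → SetVarsInʳ (Q ∘ ρ) φ →
                       NFVarsIn (InScope Q n (size (translate φ ρ n))) (translate φ ρ n)
  NFVarsIn-translate Q (const r)     ρ n h = tt ,, (tt ∷ [])
  NFVarsIn-translate Q (P a x)       ρ n h = tt ,, []
  NFVarsIn-translate Q (¬P a x)      ρ n h = tt ,, []
  NFVarsIn-translate Q (x ≤' y)      ρ n h = tt ,, []
  NFVarsIn-translate Q (x ≰' y)      ρ n h = tt ,, []
  NFVarsIn-translate Q (x ∈' X)      ρ n h = free h ,, []
  NFVarsIn-translate Q (x ∉' X)      ρ n h = free h ,, []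
  NFVarsIn-translate Q (φ ∧' ψ)      ρ n (hφ ,, hψ) =
    (proj₁ varsA ,, proj₁ varsB) ,, ++⁺ (proj₂ varsA) (proj₂ varsB)
    where
    A : NF
    A = translate φ ρ n
    B : NF
    B = translate ψ ρ (n +ℕ size A)
    varsA : NFVarsIn (InScope Q n (size A +ℕ size B)) A
    varsA = NFVarsIn-mono A (λ Z → InScope-+ˡ n (size A) (size B)) (NFVarsIn-translate Q φ ρ n hφ)
    varsB : NFVarsIn (InScope Q n (size A +ℕ size B)) B
    varsB = NFVarsIn-mono B (λ Z → InScope-+ʳ n (size A) (size B)) (NFVarsIn-translate Q ψ ρ (n +ℕ size A) hψ)
  NFVarsIn-translate Q (φ ∨' ψ)      ρ n (hφ ,, hψ) =
    ((n∈ ,, tt) ,, ((n∈ ,, (proj₁ varsA ,, zB)) ,, (n∈ ,, (proj₁ varsB ,, zA))))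
    ,, ++⁺ (SetVarsIn-guardMonos (Empty n) (monos A) n∈ (proj₂ varsA))
           (SetVarsIn-guardMonos (¬' Empty n) (monos B) n∈ (proj₂ varsB))
    where
    A : NF
    A = translate φ ρ (suc n)
    B : NF
    B = translate ψ ρ (suc n +ℕ size A)
    d : ℕ
    d = size A +ℕ size B
    n∈ : InScope Q n (suc d) n
    n∈ = InScope-base n d
    fromA : ∀ Z → InScope Q (suc n) (size A) Z → InScope Q n (suc d) Z
    fromA Z = InScope-suc n d ∘ InScope-+ˡ (suc n) (size A) (size B)
    fromB : ∀ Z → InScope Q (suc n +ℕ size A) (size B) Z → InScope Q n (suc d) Z
    fromB Z = InScope-suc n d ∘ InScope-+ʳ (suc n) (size A) (size B)
    varsA : NFVarsIn (InScope Q n (suc d)) A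
    varsA = NFVarsIn-mono A fromA (NFVarsIn-translate Q φ ρ (suc n) hφ)
    varsB : NFVarsIn (InScope Q n (suc d)) B
    varsB = NFVarsIn-mono B fromB (NFVarsIn-translate Q ψ ρ (suc n +ℕ size A) hψ)
    zA : SetVarsIn (InScope Q n (suc d)) (AllEmpty (range (suc n) (size A)))
    zA = SetVarsIn-mono (AllEmpty (range (suc n) (size A))) fromA (SetVarsIn-AllEmpty (suc n) (size A))
    zB : SetVarsIn (InScope Q n (suc d)) (AllEmpty (range (suc n +ℕ size A) (size B)))
    zB = SetVarsIn-mono (AllEmpty (range (suc n +ℕ size A) (size B))) fromB
                        (SetVarsIn-AllEmpty (suc n +ℕ size A) (size B))
  NFVarsIn-translate Q (∃₁ x φ)      ρ n h =
    ((n∈ ,, ((n∈ ,, n∈) ,, tt)) ,, (n∈ ,, proj₁ varsA)) ,, SetVarsIn-bindMonos n x (monos A) n∈ (proj₂ varsA)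
    where
    A : NF
    A = translate φ ρ (suc n)
    n∈ : InScope Q n (suc (size A)) n
    n∈ = InScope-base n (size A)
    varsA : NFVarsIn (InScope Q n (suc (size A))) A
    varsA = NFVarsIn-mono A (λ Z → InScope-suc n (size A)) (NFVarsIn-translate Q φ ρ (suc n) h)
  NFVarsIn-translate Q (∃₂ X φ)      ρ n h =
    NFVarsIn-mono A lower
      (NFVarsIn-translate (n ◃ Q) φ (ρ [ X ≔ n ]) (suc n) (SetVarsInʳ-mono φ ([≔]-◃ Q ρ X n) h))
    where
    A : NF
    A = translate φ (ρ [ X ≔ n ]) (suc n)
    lower : ∀ Z → InScope (n ◃ Q) (suc n) (size A) Z → InScope Q n (suc (size A)) Z
    lower Z (free (inj₁ refl)) = InScope-base n (size A)
    lower Z (free (inj₂ q))    = free q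
    lower Z (window n<Z Z<)    = InScope-suc n (size A) (window n<Z Z<)
  NFVarsIn-translate Q (∀₂b X ψ)     ρ n h =
    SetVarsIn-mono (translateᵇ (∀₂ X ψ) ρ n) (λ _ → free) (SetVarsIn-translateᵇ Q ρ n (∀₂ X ψ) h) ,, []
  NFVarsIn-translate Q (∀₁step x ps) ρ n h =
    SetVarsIn-stepCond Q Q x ⊤' ps ρ n (λ _ q → q) tt h ,, SetVarsIn-stepMonos x ps n

  count-minimum : ∀ (w : Word k) (σ : Assign w) → count w (λ i → sat (∀₁ 1 (0 ≤' 1)) w (σ [ 0 ↦₁ i ])) ≡ 1
  count-minimum w σ =
    trans (foldr-allFin-suc {n = length w} (λ i n → if minimal i then suc n else n) 0)
          (trans (cong (λ b → if b then suc rest else rest) (allB-true (allPos w)))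
                 (cong suc (foldr-skip (allFin (length w)))))
    where
    minimal : Pos w → Bool
    minimal i = sat (∀₁ 1 (0 ≤' 1)) w (σ [ 0 ↦₁ i ])
    rest : ℕ
    rest = foldr (λ _ n → n) 0 (allFin (length w))

  translate-correct : ∀ {w : Word k} (Q : ℕ → Set) φ ρ n → Below Q n → SetVarsInʳ (Q ∘ ρ) φ →
                      ∀ (σ : Assign w) →
                      WE φ w (renameSets σ ρ) ≈ evalNF (translate φ ρ n) n σ
  translate-correct {w} Q (const r) ρ n Q<n h σ = ≈-sym (begin
    ⟦ true ⟧ * (pow r (count w minimal) * 1#) ≈⟨ ≈-trans (*-identityˡ _) (*-identityʳ _) ⟩
    pow r (count w minimal)                  ≡⟨ cong (pow r) (count-minimum w σ) ⟩
    r * 1#                                   ≈⟨ *-identityʳ r ⟩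
    r                                        ∎)
    where
    minimal : Pos w → Bool
    minimal i = sat (∀₁ 1 (0 ≤' 1)) w (σ [ 0 ↦₁ i ])
  translate-correct Q (P a x)       ρ n Q<n h σ = ≈-sym (*-identityʳ _)
  translate-correct Q (¬P a x)      ρ n Q<n h σ = ≈-sym (*-identityʳ _)
  translate-correct Q (x ≤' y)      ρ n Q<n h σ = ≈-sym (*-identityʳ _)
  translate-correct Q (x ≰' y)      ρ n Q<n h σ = ≈-sym (*-identityʳ _)
  translate-correct Q (x ∈' X)      ρ n Q<n h σ = ≈-sym (*-identityʳ _)
  translate-correct Q (x ∉' X)      ρ n Q<n h σ = ≈-sym (*-identityʳ _)
  translate-correct Q (φ ∧' ψ)      ρ n Q<n (hφ ,, hψ) σ =
    ≈-trans (*-cong (translate-correct Q φ ρ n Q<n hφ σ) (translate-correct Q ψ ρ (n +ℕ size A) Q<n+d hψ σ))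
            (≈-sym (evalNF-⊗ A B n Q<n (NFVarsIn-translate Q φ ρ n hφ)
                                       (NFVarsIn-translate Q ψ ρ (n +ℕ size A) hψ) σ))
    where
    A : NF
    A = translate φ ρ n
    B : NF
    B = translate ψ ρ (n +ℕ size A)
    Q<n+d : Below Q (n +ℕ size A)
    Q<n+d Z q = ≤-trans (Q<n Z q) (m≤m+n n (size A))
  translate-correct Q (φ ∨' ψ)      ρ n Q<n (hφ ,, hψ) σ =
    ≈-trans (+-cong (translate-correct Q φ ρ (suc n) Q<n+1 hφ σ)
                    (translate-correct Q ψ ρ (suc n +ℕ size A) Q<n+1+d hψ σ))
            (≈-sym (evalNF-orNF A B n Q<n (NFVarsIn-translate Q φ ρ (suc n) hφ)
                                          (NFVarsIn-translate Q ψ ρ (suc n +ℕ size A) hψ) σ))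
    where
    A : NF
    A = translate φ ρ (suc n)
    B : NF
    B = translate ψ ρ (suc n +ℕ size A)
    Q<n+1 : Below Q (suc n)
    Q<n+1 Z q = m<n⇒m<1+n (Q<n Z q)
    Q<n+1+d : Below Q (suc n +ℕ size A)
    Q<n+1+d Z q = ≤-trans (Q<n+1 Z q) (m≤m+n (suc n) (size A))
  translate-correct {w} Q (∃₁ x φ)  ρ n Q<n h σ =
    ≈-trans (Σ+-cong (λ p → translate-correct Q φ ρ (suc n) Q<n+1 h (σ [ x ↦₁ p ])) (allPos w))
            (≈-sym (evalNF-exNF (translate φ ρ (suc n)) n x Q<n (NFVarsIn-translate Q φ ρ (suc n) h) σ))
    where
    Q<n+1 : Below Q (suc n)
    Q<n+1 Z q = m<n⇒m<1+n (Q<n Z q)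
  translate-correct {w} Q (∃₂ X φ)  ρ n Q<n h σ =
    Σ+-cong (λ A → ≈-trans (WE-cong φ h (Agree-sym (renameSets-update Q ρ n X σ A Q<n)))
                           (translate-correct (n ◃ Q) φ (ρ [ X ≔ n ]) (suc n) (Below-◃ {Q = Q} n Q<n)
                                              (SetVarsInʳ-mono φ ([≔]-◃ Q ρ X n) h) (σ [ n ↦₂ A ])))
            (allSets w)
  translate-correct {w} Q (∀₂b X ψ) ρ n Q<n h σ =
    ≈-trans (≈-sym (⟦allB⟧ (λ A → bsat ψ w (renameSets σ ρ [ X ↦₂ A ])) (allSets w)))
            (≈-trans (reflexive (cong ⟦_⟧ (sym (sat-translateᵇ Q ρ n Q<n (∀₂ X ψ) h σ))))
                     (≈-sym (*-identityʳ _)))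
  translate-correct Q (∀₁step x ps) ρ n Q<n h σ = ≈-sym (sum-stepCond Q Q x ⊤' ps ρ n Q<n (λ _ q → q) tt h σ)

  expressible : ∀ (φ : RMSOL k Carrier) →
                Σ (Expr k Carrier) (λ t → ∀ (w : Word k) (σ : Assign w) → WE φ w σ ≈ Eval.E S t w σ)
  expressible φ = sum (range n (size A)) (cond A) (prod (monos A))
               ,, λ w σ → translate-correct (_< n) φ id n (λ _ Z<n → Z<n) (SetVarsInʳ-< φ) σ
    where
    n : ℕ
    n = setVarBoundʳ φ
    A : NF
    A = translate φ id n

theorem16 : ∀ {c ℓ} (S : CommutativeSemiring c ℓ) (k : ℕ)
              (φ : RMSOL k (CommutativeSemiring.Carrier S)) →
              Σ (Expr k (CommutativeSemiring.Carrier S)) (λ t →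
                ∀ (w : Word k) (σ : Assign w) →
                  CommutativeSemiring._≈_ S (Sem.WE S φ w σ) (Eval.E S t w σ))
theorem16 S k = Translation.expressible S k
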